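{- Let $F$ be a regular class of first order formulas and let $G$ be a digraph definable by a sentence in $F$. Then $$L_F(G)<\mathrm{Tower}\bigl(D_F(G)+\log^*D_F(G)+2\bigr).$$
   Context: A digraph is a finite non-empty vertex set with a binary arc relation (loops allowed). First order formulas about digraphs use variables over vertices, relations $=$ and $\mapsto$ (arc), $\forall,\exists,\vee,\wedge,\neg$, parentheses. A sentence defines $G$ if it is true on $G$ and false on every digraph not isomorphic to $G$. $L(\Phi)$ is the number of symbols of $\Phi$, and the quantifier rank $D(\Phi)$ is the maximum number of nested quantifiers. For a class $F$ of formulas, $L_F(G)$ (resp. $D_F(G)$) is the minimum of $L(\Phi)$ (resp. $D(\Phi)$) over sentences $\Phi\in F$ defining $G$. Writing $A(x_1,\dots,x_s)$ means $x_1,\dots,x_s$ are exactly the free variables of $A$. A formula $A(x_1,\dots,x_s)$ of quantifier rank $k-s$ is normal if all negations in $A$ occur only in front of atomic subformulas, $A$ contains occurrences of the variables $x_1,\dots,x_k$ only, and every sequence of nested quantifiers of $A$ has length $k-s$ and quantifies the variables $x_{s+1},\dots,x_k$ exactly in this order. A normal form of $A(x_1,\dots,x_s)$ is a normal formula with the same free variables and the same quantifier rank that is equivalent to $A$. A class $F$ is regular if (i) $F$ is closed under taking subformulas and under renaming bound variables; (ii) for each $A\in F$, $F$ contains a normal form of $A$; (iii) for every $k\ge1$ there is a set $P^k\subseteq\{\forall,\exists\}^k$ such that a normal sentence $A$ of quantifier rank $k$ belongs to $F$ iff every sequence of nested quantifiers of $A$ belongs to $P^k$. $\mathrm{Tower}(0)=1$,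 $\mathrm{Tower}(i)=2^{\mathrm{Tower}(i-1)}$; $\log^*n$ is the minimum number of iterations of $\log_2$ bringing $n$ to $1$ or below. -}

module Defs where

open import Data.Nat using (ℕ; zero; suc; _+_; _^_; _≤_; _<_; _≡ᵇ_; _≤ᵇ_)
open import Data.Nat.Logarithm using (⌈log₂_⌉)
open import Data.Bool using (Bool; true; false; if_then_else_)
open import Data.Fin using (Fin)
open import Data.List using (List; []; _∷_; map)
open import Data.Product using (Σ; _×_; _,_; proj₁; proj₂)
open import Data.Sum using (_⊎_)
open import Function.Bundles using (_↔_; Inverse)
open import Relation.Nullary using (¬_)
open import Relation.Binary.PropositionalEquality using (_≡_; _≢_)

-- Digraphs: vertex set Fin (suc n) (finite, non-empty), arc relation
-- given as a Boolean matrix (loops allowed).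

record Digraph : Set where
  field
    size : ℕ
    arc  : Fin (suc size) → Fin (suc size) → Bool

open Digraph public

Vertex : Digraph → Set
Vertex G = Fin (suc (size G))

record _≅_ (H G : Digraph) : Set where
  field
    bij      : Vertex H ↔ Vertex G
    preserve : ∀ u v → arc H u v ≡ arc G (Inverse.to bij u) (Inverse.to bij v)

-- First-order formulas.  Variable x_{i+1} is represented by i : ℕ.

data Quant : Set where
  ∀q ∃q : Quant

data Formula : Set where
  _≐_  : ℕ → ℕ → Formula
  _⟼_  : ℕ → ℕ → Formula
  ¬'_  : Formula → Formula
  _∧'_ : Formula → Formula → Formula
  _∨'_ : Formula → Formula → Formula
  Q    : Quant → ℕ → Formula → Formula

-- length: each occurrence of a variable, relation symbol, connective,
-- quantifier and parenthesis counts 1.  Binary connectives come with a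
-- pair of parentheses:  (A ∧ B).
L : Formula → ℕ
L (x ≐ y)   = 3
L (x ⟼ y)   = 3
L (¬' A)    = 1 + L A
L (A ∧' B)  = 3 + L A + L B
L (A ∨' B)  = 3 + L A + L B
L (Q q x A) = 2 + L A

D : Formula → ℕ
D (x ≐ y)   = 0
D (x ⟼ y)   = 0
D (¬' A)    = D A
D (A ∧' B)  = D A Data.Nat.⊔ D B
D (A ∨' B)  = D A Data.Nat.⊔ D B
D (Q q x A) = suc (D A)

Free : ℕ → Formula → Set
Free z (x ≐ y)   = z ≡ x ⊎ z ≡ y
Free z (x ⟼ y)   = z ≡ x ⊎ z ≡ y
Free z (¬' A)    = Free z A
Free z (A ∧' B)  = Free z A ⊎ Free z B
Free z (A ∨' B)  = Free z A ⊎ Free z B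
Free z (Q q x A) = z ≢ x × Free z A

Occurs : ℕ → Formula → Set
Occurs z (x ≐ y)   = z ≡ x ⊎ z ≡ y
Occurs z (x ⟼ y)   = z ≡ x ⊎ z ≡ y
Occurs z (¬' A)    = Occurs z A
Occurs z (A ∧' B)  = Occurs z A ⊎ Occurs z B
Occurs z (A ∨' B)  = Occurs z A ⊎ Occurs z B
Occurs z (Q q x A) = z ≡ x ⊎ Occurs z A

Sentence : Formula → Set
Sentence A = ∀ z → ¬ Free z A

Assignment : Digraph → Set
Assignment G = ℕ → Vertex G

update : ∀ G → Assignment G → ℕ → Vertex G → Assignment G
update G ρ x v y = if y ≡ᵇ x then v else ρ y

Sat : (G : Digraph) → Assignment G → Formula → Set
Sat G ρ (x ≐ y)    = ρ x ≡ ρ y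
Sat G ρ (x ⟼ y)    = arc G (ρ x) (ρ y) ≡ true
Sat G ρ (¬' A)     = ¬ Sat G ρ A
Sat G ρ (A ∧' B)   = Sat G ρ A × Sat G ρ B
Sat G ρ (A ∨' B)   = Sat G ρ A ⊎ Sat G ρ B
Sat G ρ (Q ∀q x A) = (v : Vertex G) → Sat G (update G ρ x v) A
Sat G ρ (Q ∃q x A) = Σ (Vertex G) λ v → Sat G (update G ρ x v) A

Holds : Digraph → Formula → Set
Holds G A = (ρ : Assignment G) → Sat G ρ A

Equivalent : Formula → Formula → Set
Equivalent A B = ∀ G (ρ : Assignment G) → (Sat G ρ A → Sat G ρ B) × (Sat G ρ B → Sat G ρ A)

Defines : Formula → Digraph → Set
Defines Φ G = Sentence Φ × Holds G Φ × (∀ H → ¬ (H ≅ G) → ¬ Holds H Φ)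

rename : ℕ → ℕ → Formula → Formula
rename x y (a ≐ b)   = (if a ≡ᵇ x then y else a) ≐ (if b ≡ᵇ x then y else b)
rename x y (a ⟼ b)   = (if a ≡ᵇ x then y else a) ⟼ (if b ≡ᵇ x then y else b)
rename x y (¬' A)    = ¬' rename x y A
rename x y (A ∧' B)  = rename x y A ∧' rename x y B
rename x y (A ∨' B)  = rename x y A ∨' rename x y B
rename x y (Q q z A) = if z ≡ᵇ x then Q q z A else Q q z (rename x y A)

data RenStep : Formula → Formula → Set where
  here  : ∀ q x y A → ¬ Occurs y A → RenStep (Q q x A) (Q q y (rename x y A))
  in¬   : ∀ {A A'} → RenStep A A' → RenStep (¬' A) (¬' A')
  in∧ˡ  : ∀ {A A' B} → RenStep A A' → RenStep (A ∧' B) (A' ∧' B)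
  in∧ʳ  : ∀ {A B B'} → RenStep B B' → RenStep (A ∧' B) (A ∧' B')
  in∨ˡ  : ∀ {A A' B} → RenStep A A' → RenStep (A ∨' B) (A' ∨' B)
  in∨ʳ  : ∀ {A B B'} → RenStep B B' → RenStep (A ∨' B) (A ∨' B')
  inQ   : ∀ {q x A A'} → RenStep A A' → RenStep (Q q x A) (Q q x A')

data NNF : Formula → Set where
  atom≐  : ∀ x y → NNF (x ≐ y)
  atom⟼  : ∀ x y → NNF (x ⟼ y)
  neg≐   : ∀ x y → NNF (¬' (x ≐ y))
  neg⟼   : ∀ x y → NNF (¬' (x ⟼ y))
  and    : ∀ {A B} → NNF A → NNF B → NNF (A ∧' B)
  or     : ∀ {A B} → NNF A → NNF B → NNF (A ∨' B)
  quant  : ∀ {q x A} → NNF A → NNF (Q q x A)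

data Path : Formula → List (Quant × ℕ) → Set where
  p≐   : ∀ x y → Path (x ≐ y) []
  p⟼   : ∀ x y → Path (x ⟼ y) []
  p¬   : ∀ {A σ} → Path A σ → Path (¬' A) σ
  p∧ˡ  : ∀ {A B σ} → Path A σ → Path (A ∧' B) σ
  p∧ʳ  : ∀ {A B σ} → Path B σ → Path (A ∧' B) σ
  p∨ˡ  : ∀ {A B σ} → Path A σ → Path (A ∨' B) σ
  p∨ʳ  : ∀ {A B σ} → Path B σ → Path (A ∨' B) σ
  pQ   : ∀ {q x A σ} → Path A σ → Path (Q q x A) ((q , x) ∷ σ)

range : ℕ → ℕ → List ℕ
range s zero    = []
range s (suc r) = s ∷ range (suc s) r

FreeExactly : ℕ → Formula → Set
FreeExactly s A = ∀ z → (Free z A → z < s) × (z < s → Free z A)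

Normal : ℕ → ℕ → Formula → Set
Normal s r A =
  FreeExactly s A × D A ≡ r × NNF A ×
  (∀ z → Occurs z A → z < s + r) ×
  (∀ σ → Path A σ → map proj₂ σ ≡ range s r)

NormalForm : ℕ → Formula → Formula → Set
NormalForm s A B = Normal s (D A) B × Equivalent A B

record Regular (F : Formula → Set) : Set₁ where
  field
    sub¬  : ∀ {A} → F (¬' A) → F A
    sub∧  : ∀ {A B} → F (A ∧' B) → F A × F B
    sub∨  : ∀ {A B} → F (A ∨' B) → F A × F B
    subQ  : ∀ {q x A} → F (Q q x A) → F A
    ren   : ∀ {A B} → F A → RenStep A B → F B
    normal : ∀ s A → F A → FreeExactly s A → Σ Formula λ B → F B × NormalForm s A B
    prefixes : ∀ k → 1 ≤ k → Σ (List Quant → Set) λ P →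
      ∀ A → Normal 0 k A →
        (F A → ∀ σ → Path A σ → P (map proj₁ σ)) ×
        ((∀ σ → Path A σ → P (map proj₁ σ)) → F A)

Definable : (Formula → Set) → Digraph → Set
Definable F G = Σ Formula λ Φ → F Φ × Defines Φ G

IsLF : (Formula → Set) → Digraph → ℕ → Set
IsLF F G l = (Σ Formula λ Φ → F Φ × Defines Φ G × L Φ ≡ l) ×
             (∀ Φ → F Φ → Defines Φ G → l ≤ L Φ)

IsDF : (Formula → Set) → Digraph → ℕ → Set
IsDF F G d = (Σ Formula λ Φ → F Φ × Defines Φ G × D Φ ≡ d) ×
             (∀ Φ → F Φ → Defines Φ G → d ≤ D Φ)

Tower : ℕ → ℕ
Tower zero    = 1
Tower (suc i) = 2 ^ Tower i

-- iterate ⌈log₂⌉ until ≤ 1 (fuel argument; fuel n suffices for n).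
-- Iterating ⌈log₂⌉ on integers yields the same count as iterating the
-- real log₂, since ⌈log₂ ⌈y⌉⌉ = ⌈log₂ y⌉ and ⌈y⌉ ≤ 1 ⇔ y ≤ 1.
log*-fuel : ℕ → ℕ → ℕ
log*-fuel zero    n = 0
log*-fuel (suc f) n = if n ≤ᵇ 1 then 0 else suc (log*-fuel f ⌈log₂ n ⌉)

log* : ℕ → ℕ
log* n = log*-fuel n n

-- Let B be the normal form in F of a defining sentence of minimal rank d. A sentence in
-- which only x₀ occurs cannot tell G from G with a vertex doubled, so d ≥ 2. For an
-- assignment σ of x₀ … x₍ₛ₋₁₎ and a trie t of quantifier strings, the Hintikka formula of
-- σ is the conjunction of the literals true at σ if t is a leaf; otherwise it is made of
-- ⋀ ∃xₛ φ for the ∃-subtrie and ∀xₛ ⋁ φ for the ∀-subtrie, with φ ranging over the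
-- distinct Hintikka formulas of the extensions σ[s ↦ v]. It holds at σ and, by induction
-- on normal formulas, entails every normal formula true at σ whose quantifier strings lie
-- in t. For t the quantifier strings of B, the Hintikka sentence is normal with the
-- quantifier strings of B, lies in F by regularity, and defines G. Its length depends on
-- d alone: rank-r Hintikka formulas take at most 2^c(r) values, where c(0) is the number
-- of atoms and c(r+1) = 2^(c(r)+1), which yields a tower of height d + log* d + 2.

{-# OPTIONS --safe #-}
module Submission where

open import Defs
open import Data.Nat using (ℕ; zero; suc; _+_; _*_; _^_; _≤_; _<_; _≡ᵇ_; _⊔_; z≤n; s≤s; s≤s⁻¹; ⌈_/2⌉)
open import Data.Nat.Properties
open import Data.Bool using (Bool; true; false; T; _∧_)
import Data.Bool
open import Data.Bool.Properties using (T?; T-∧)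
open import Data.Fin using (Fin)
import Data.Fin as Fin
open import Data.Fin.Properties using (any?; injective⇒≤)
open import Data.Nat.Logarithm using (⌈log₂_⌉; ⌈log₂⌉-mono-≤; ⌈log₂2^n⌉≡n)
open import Data.Nat.Logarithm.Core using (⌈log2⌉)
open import Data.Nat.Induction using (<-wellFounded)
open import Induction.WellFounded using (Acc; acc)
open import Data.List using (List; []; _∷_; _++_; map; length; filter; upTo; cartesianProductWith)
open import Data.List.Properties using (length-++; length-map; length-upTo; length-filter; ∷-injectiveˡ; ∷-injectiveʳ)
open import Data.List.Relation.Unary.All using (All; []; _∷_)
import Data.List.Relation.Unary.All as All
import Data.List.Relation.Unary.All.Properties as All
open import Data.List.Relation.Unary.Any using (Any; here; there)
open import Data.List.Membership.Propositional using (_∈_; find; lose)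
open import Data.List.Membership.Propositional.Properties
open import Data.Product using (∃-syntax; _×_; _,_; proj₁; proj₂)
open import Data.Sum using (_⊎_; inj₁; inj₂; [_,_])
open import Data.Empty using (⊥; ⊥-elim)
open import Data.Unit using (⊤; tt)
open import Data.Maybe using (Maybe; just; nothing)
open import Relation.Nullary using (¬_; Dec; yes; no)
open import Relation.Nullary.Decidable using (map′)
open import Relation.Binary.Definitions using (DecidableEquality; tri<; tri≈; tri>)
open import Relation.Binary.PropositionalEquality hiding ([_])
open import Data.Nat.Tactic.RingSolver using (solve-∀)
open import Function using (_∘_)
open import Function.Bundles using (_⇔_; mk⇔; Equivalence; Injection)
open import Function.Properties.Inverse using (↔⇒↣)
open import Data.Product.Function.NonDependent.Propositional using (_×-⇔_)
open import Data.Sum.Function.Propositional using (_⊎-⇔_)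

2^-double : ∀ n → 2 ^ n + 2 ^ n ≡ 2 ^ suc n
2^-double n = cong (2 ^ n +_) (sym (+-identityʳ (2 ^ n)))

module _ {A : Set} where

  sublists : List A → List (List A)
  sublists []       = [] ∷ []
  sublists (x ∷ xs) = map (x ∷_) (sublists xs) ++ sublists xs

  length-sublists : ∀ xs → length (sublists xs) ≡ 2 ^ length xs
  length-sublists []       = refl
  length-sublists (x ∷ xs) = begin
    length (map (x ∷_) (sublists xs) ++ sublists xs)
      ≡⟨ length-++ (map (x ∷_) (sublists xs)) ⟩
    length (map (x ∷_) (sublists xs)) + length (sublists xs)
      ≡⟨ cong (_+ length (sublists xs)) (length-map (x ∷_) (sublists xs)) ⟩
    length (sublists xs) + length (sublists xs)
      ≡⟨ cong (λ k → k + k) (length-sublists xs) ⟩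
    2 ^ length xs + 2 ^ length xs
      ≡⟨ 2^-double (length xs) ⟩
    2 ^ suc (length xs) ∎
    where open ≡-Reasoning

  filter∈sublists : ∀ {P : A → Set} (P? : ∀ x → Dec (P x)) xs → filter P? xs ∈ sublists xs
  filter∈sublists P? []       = here refl
  filter∈sublists P? (x ∷ xs) with P? x
  ... | yes _ = ∈-++⁺ˡ (∈-map⁺ (x ∷_) (filter∈sublists P? xs))
  ... | no  _ = ∈-++⁺ʳ (map (x ∷_) (sublists xs)) (filter∈sublists P? xs)

length-cartesianProductWith : ∀ {A B C : Set} (f : A → B → C) xs ys →
  length (cartesianProductWith f xs ys) ≡ length xs * length ys
length-cartesianProductWith f []       ys = refl
length-cartesianProductWith f (x ∷ xs) ys = begin
  length (map (f x) ys ++ cartesianProductWith f xs ys)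
    ≡⟨ length-++ (map (f x) ys) ⟩
  length (map (f x) ys) + length (cartesianProductWith f xs ys)
    ≡⟨ cong₂ _+_ (length-map (f x) ys) (length-cartesianProductWith f xs ys) ⟩
  length ys + length xs * length ys ∎
  where open ≡-Reasoning


_==ᵠ_ : Quant → Quant → Bool
∀q ==ᵠ ∀q = true
∃q ==ᵠ ∃q = true
_  ==ᵠ _  = false

_==_ : Formula → Formula → Bool
(a ≐ b)   == (c ≐ d)   = (a ≡ᵇ c) ∧ (b ≡ᵇ d)
(a ⟼ b)   == (c ⟼ d)   = (a ≡ᵇ c) ∧ (b ≡ᵇ d)
(¬' A)    == (¬' B)    = A == B
(A ∧' B)  == (C ∧' D)  = (A == C) ∧ (B == D)
(A ∨' B)  == (C ∨' D)  = (A == C) ∧ (B == D)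
(Q q x A) == (Q p y B) = (q ==ᵠ p) ∧ ((x ≡ᵇ y) ∧ (A == B))
_         == _         = false

==ᵠ⇒≡ : ∀ q p → T (q ==ᵠ p) → q ≡ p
==ᵠ⇒≡ ∀q ∀q _ = refl
==ᵠ⇒≡ ∃q ∃q _ = refl

==⇒≡ : ∀ A B → T (A == B) → A ≡ B
==⇒≡ (a ≐ b)   (c ≐ d)   t with a≡c , b≡d ← Equivalence.to T-∧ t =
  cong₂ _≐_ (≡ᵇ⇒≡ a c a≡c) (≡ᵇ⇒≡ b d b≡d)
==⇒≡ (a ⟼ b)   (c ⟼ d)   t with a≡c , b≡d ← Equivalence.to T-∧ t =
  cong₂ _⟼_ (≡ᵇ⇒≡ a c a≡c) (≡ᵇ⇒≡ b d b≡d)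
==⇒≡ (¬' A)    (¬' B)    t = cong ¬'_ (==⇒≡ A B t)
==⇒≡ (A ∧' B)  (C ∧' D)  t with A≡C , B≡D ← Equivalence.to T-∧ t =
  cong₂ _∧'_ (==⇒≡ A C A≡C) (==⇒≡ B D B≡D)
==⇒≡ (A ∨' B)  (C ∨' D)  t with A≡C , B≡D ← Equivalence.to T-∧ t =
  cong₂ _∨'_ (==⇒≡ A C A≡C) (==⇒≡ B D B≡D)
==⇒≡ (Q q x A) (Q p y B) t
  with q≡p , rest ← Equivalence.to T-∧ t
  with x≡y , A≡B ← Equivalence.to T-∧ rest
  with refl ← ==ᵠ⇒≡ q p q≡p | refl ← ≡ᵇ⇒≡ x y x≡y | refl ← ==⇒≡ A B A≡B = refl

==-refl : ∀ A → T (A == A)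
==-refl (a ≐ b)   = Equivalence.from T-∧ (≡⇒≡ᵇ a a refl , ≡⇒≡ᵇ b b refl)
==-refl (a ⟼ b)   = Equivalence.from T-∧ (≡⇒≡ᵇ a a refl , ≡⇒≡ᵇ b b refl)
==-refl (¬' A)    = ==-refl A
==-refl (A ∧' B)  = Equivalence.from T-∧ (==-refl A , ==-refl B)
==-refl (A ∨' B)  = Equivalence.from T-∧ (==-refl A , ==-refl B)
==-refl (Q ∀q x A) = Equivalence.from T-∧ (tt , Equivalence.from T-∧ (≡⇒≡ᵇ x x refl , ==-refl A))
==-refl (Q ∃q x A) = Equivalence.from T-∧ (tt , Equivalence.from T-∧ (≡⇒≡ᵇ x x refl , ==-refl A))

_≟ᶠ_ : DecidableEquality Formula
A ≟ᶠ B = map′ (==⇒≡ A B) (λ { refl → ==-refl A }) (T? (A == B))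


update-cong : ∀ G {ρ ρ′ : Assignment G} x v z → (z ≢ x → ρ z ≡ ρ′ z) →
              update G ρ x v z ≡ update G ρ′ x v z
update-cong G x v z agree with z ≡ᵇ x in eq
... | true  = refl
... | false = agree (λ { refl → subst T eq (≡⇒≡ᵇ z z refl) })

coincidence : ∀ G A {ρ ρ′ : Assignment G} → (∀ z → Free z A → ρ z ≡ ρ′ z) →
              Sat G ρ A → Sat G ρ′ A
coincidence G (x ≐ y)    agree s = trans (sym (agree x (inj₁ refl))) (trans s (agree y (inj₂ refl)))
coincidence G (x ⟼ y)    agree s =
  subst₂ (λ u v → arc G u v ≡ true) (agree x (inj₁ refl)) (agree y (inj₂ refl)) s
coincidence G (¬' A)     agree s = s ∘ coincidence G A (λ z f → sym (agree z f))
coincidence G (A ∧' B)   agree (a , b) =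
  coincidence G A (λ z → agree z ∘ inj₁) a , coincidence G B (λ z → agree z ∘ inj₂) b
coincidence G (A ∨' B)   agree (inj₁ a) = inj₁ (coincidence G A (λ z → agree z ∘ inj₁) a)
coincidence G (A ∨' B)   agree (inj₂ b) = inj₂ (coincidence G B (λ z → agree z ∘ inj₂) b)
coincidence G (Q ∀q x A) {ρ} {ρ′} agree s v =
  coincidence G A (λ z f → update-cong G {ρ} {ρ′} x v z (λ z≢x → agree z (z≢x , f))) (s v)
coincidence G (Q ∃q x A) {ρ} {ρ′} agree (v , s) =
  v , coincidence G A (λ z f → update-cong G {ρ} {ρ′} x v z (λ z≢x → agree z (z≢x , f))) s

sentence-closed : ∀ G A {ρ ρ′ : Assignment G} → Sentence A → Sat G ρ A → Sat G ρ′ A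
sentence-closed G A closed = coincidence G A (λ z f → ⊥-elim (closed z f))

Free⇒Occurs : ∀ {z} A → Free z A → Occurs z A
Free⇒Occurs (x ≐ y)   f         = f
Free⇒Occurs (x ⟼ y)   f         = f
Free⇒Occurs (¬' A)    f         = Free⇒Occurs A f
Free⇒Occurs (A ∧' B)  (inj₁ f)  = inj₁ (Free⇒Occurs A f)
Free⇒Occurs (A ∧' B)  (inj₂ f)  = inj₂ (Free⇒Occurs B f)
Free⇒Occurs (A ∨' B)  (inj₁ f)  = inj₁ (Free⇒Occurs A f)
Free⇒Occurs (A ∨' B)  (inj₂ f)  = inj₂ (Free⇒Occurs B f)
Free⇒Occurs (Q q x A) (_ , f)   = inj₂ (Free⇒Occurs A f)

somePath : ∀ A → ∃[ π ] Path A π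
somePath (x ≐ y)   = _ , p≐ x y
somePath (x ⟼ y)   = _ , p⟼ x y
somePath (¬' A)    = _ , p¬ (proj₂ (somePath A))
somePath (A ∧' B)  = _ , p∧ˡ (proj₂ (somePath A))
somePath (A ∨' B)  = _ , p∨ˡ (proj₂ (somePath A))
somePath (Q q x A) = _ , pQ (proj₂ (somePath A))

someOccurrence : ∀ A → ∃[ z ] Occurs z A
someOccurrence (x ≐ y)   = x , inj₁ refl
someOccurrence (x ⟼ y)   = x , inj₁ refl
someOccurrence (¬' A)    = someOccurrence A
someOccurrence (A ∧' B)  = Data.Product.map₂ inj₁ (someOccurrence A)
someOccurrence (A ∨' B)  = Data.Product.map₂ inj₁ (someOccurrence A)
someOccurrence (Q q x A) = x , inj₁ refl

module Iterated (_∙_ : Formula → Formula → Formula) where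

  -- The value at the empty list is junk: every list folded below is nonempty.
  big : List Formula → Formula
  big []           = 0 ⟼ 0
  big (A ∷ [])     = A
  big (A ∷ B ∷ As) = A ∙ big (B ∷ As)

  module _ (P : Formula → Set) where

    All⇒big : (∀ {A B} → P A → P B → P (A ∙ B)) → ∀ {A As} → A ∈ As → All P As → P (big As)
    All⇒big _    {As = _ ∷ []}     _ (p ∷ []) = p
    All⇒big step {As = _ ∷ _ ∷ _} _ (p ∷ ps) = step p (All⇒big step (here refl) ps)

    big⇒Any : (∀ {A B} → P (A ∙ B) → P A ⊎ P B) → ∀ {A As} → A ∈ As → P (big As) → Any P As
    big⇒Any _     {As = _ ∷ []}     _ p = here p
    big⇒Any split {As = _ ∷ _ ∷ _} _ p = [ here , there ∘ big⇒Any split (here refl) ] (split p)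

    big⇒All : (∀ {A B} → P (A ∙ B) → P A × P B) → ∀ As → P (big As) → All P As
    big⇒All _     []           _ = []
    big⇒All _     (_ ∷ [])     p = p ∷ []
    big⇒All split (_ ∷ B ∷ As) p = proj₁ (split p) ∷ big⇒All split (B ∷ As) (proj₂ (split p))

    Any⇒big : (∀ {A B} → P A ⊎ P B → P (A ∙ B)) → ∀ {As} → Any P As → P (big As)
    Any⇒big _    {_ ∷ []}     (here p)  = p
    Any⇒big join {_ ∷ _ ∷ _} (here p)  = join (inj₁ p)
    Any⇒big join {_ ∷ _ ∷ _} (there p) = join (inj₂ (Any⇒big join p))

  L-big : (∀ A B → L (A ∙ B) ≡ 3 + L A + L B) →
          ∀ {ℓ} As → All (λ A → L A ≤ ℓ) As → L (big As) ≤ 3 + length As * (ℓ + 3)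
  L-big _ []           []       = m≤m+n 3 0
  L-big _ {ℓ} (A ∷ [])     (p ∷ []) = begin
    L A                  ≤⟨ p ⟩
    ℓ                    ≤⟨ m≤n+m ℓ 3 ⟩
    3 + ℓ                ≤⟨ +-monoʳ-≤ 3 (≤-trans (m≤m+n ℓ 3) (m≤m+n (ℓ + 3) 0)) ⟩
    3 + 1 * (ℓ + 3)      ∎
    where open ≤-Reasoning
  L-big L∙ {ℓ} (A ∷ B ∷ As) (p ∷ ps) = begin
    L (A ∙ big (B ∷ As))                      ≡⟨ L∙ A (big (B ∷ As)) ⟩
    3 + L A + L (big (B ∷ As))                ≤⟨ +-mono-≤ (+-monoʳ-≤ 3 p) (L-big L∙ (B ∷ As) ps) ⟩
    3 + ℓ + (3 + length (B ∷ As) * (ℓ + 3))   ≡⟨ regroup ℓ (length (B ∷ As)) ⟩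
    3 + suc (length (B ∷ As)) * (ℓ + 3)       ∎
    where
    open ≤-Reasoning
    regroup : ∀ ℓ n → 3 + ℓ + (3 + n * (ℓ + 3)) ≡ 3 + suc n * (ℓ + 3)
    regroup = solve-∀

open Iterated _∧'_ using ()
  renaming (big to ⋀; All⇒big to All⇒⋀; big⇒All to ⋀⇒All; L-big to L-⋀)
open Iterated _∨'_ using ()
  renaming (big to ⋁; All⇒big to All⇒⋁; big⇒Any to ⋁⇒Any; Any⇒big to Any⇒⋁; L-big to L-⋁)

⋀∃ : ℕ → List Formula → Formula
⋀∃ s Φs = ⋀ (map (Q ∃q s) Φs)

∀⋁ : ℕ → List Formula → Formula
∀⋁ s Φs = Q ∀q s (⋁ Φs)

module _ {G : Digraph} {ρ : Assignment G} {s : ℕ} where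

  ⋀∃⁺ : ∀ {φ Φs} → φ ∈ Φs → (∀ {ψ} → ψ ∈ Φs → Sat G ρ (Q ∃q s ψ)) → Sat G ρ (⋀∃ s Φs)
  ⋀∃⁺ φ∈ h = All⇒⋀ (Sat G ρ) _,_ (∈-map⁺ (Q ∃q s) φ∈) (All.map⁺ (All.tabulate h))

  ⋀∃⁻ : ∀ {φ Φs} → Sat G ρ (⋀∃ s Φs) → φ ∈ Φs → Sat G ρ (Q ∃q s φ)
  ⋀∃⁻ {Φs = Φs} h φ∈ =
    All.lookup (⋀⇒All (Sat G ρ) (λ p → p) (map (Q ∃q s) Φs) h) (∈-map⁺ (Q ∃q s) φ∈)

  ∀⋁⁺ : ∀ {Φs} → (∀ w → ∃[ ψ ] ψ ∈ Φs × Sat G (update G ρ s w) ψ) → Sat G ρ (∀⋁ s Φs)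
  ∀⋁⁺ h w = let _ , ψ∈ , sat = h w in Any⇒⋁ (Sat G (update G ρ s w)) (λ p → p) (lose ψ∈ sat)

  ∀⋁⁻ : ∀ {φ Φs} → φ ∈ Φs → Sat G ρ (∀⋁ s Φs) → ∀ w → ∃[ ψ ] ψ ∈ Φs × Sat G (update G ρ s w) ψ
  ∀⋁⁻ φ∈ h w = find (⋁⇒Any (Sat G (update G ρ s w)) (λ p → p) φ∈ (h w))

data Atom : Set where
  _≐ₐ_ _⟼ₐ_ : ℕ → ℕ → Atom

atom : Atom → Formula
atom (x ≐ₐ y) = x ≐ y
atom (x ⟼ₐ y) = x ⟼ y

-- Equalities are only listed as x ≐ y with x < y; the count of atoms matters for the bound.
data Below (s : ℕ) : Atom → Set where
  arc< : ∀ {x y} → x < s → y < s → Below s (x ⟼ₐ y)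
  eq<  : ∀ {x y} → x < y → y < s → Below s (x ≐ₐ y)

freshAtoms : ℕ → List Atom
freshAtoms s = (s ⟼ₐ s) ∷ map (_⟼ₐ s) (upTo s) ++ map (s ⟼ₐ_) (upTo s) ++ map (_≐ₐ s) (upTo s)

atoms : ℕ → List Atom
atoms zero    = []
atoms (suc s) = freshAtoms s ++ atoms s

Below-suc : ∀ {s α} → Below s α → Below (suc s) α
Below-suc (arc< x<s y<s) = arc< (m<n⇒m<1+n x<s) (m<n⇒m<1+n y<s)
Below-suc (eq< x<y y<s)  = eq< x<y (m<n⇒m<1+n y<s)

∈-atoms⁺ : ∀ {s α} → Below s α → α ∈ atoms s
∈-atoms⁺ {suc s} (arc< x<1+s y<1+s) with m<1+n⇒m<n∨m≡n x<1+s | m<1+n⇒m<n∨m≡n y<1+s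
... | inj₂ refl | inj₂ refl = here refl
... | inj₁ x<s  | inj₂ refl = there (∈-++⁺ˡ (∈-++⁺ˡ (∈-map⁺ (_⟼ₐ s) (∈-upTo⁺ x<s))))
... | inj₂ refl | inj₁ y<s  =
  there (∈-++⁺ˡ (∈-++⁺ʳ (map (_⟼ₐ s) (upTo s)) (∈-++⁺ˡ (∈-map⁺ (s ⟼ₐ_) (∈-upTo⁺ y<s)))))
... | inj₁ x<s  | inj₁ y<s  = ∈-++⁺ʳ (freshAtoms s) (∈-atoms⁺ (arc< x<s y<s))
∈-atoms⁺ {suc s} (eq< x<y y<1+s) with m<1+n⇒m<n∨m≡n y<1+s
... | inj₂ refl = there (∈-++⁺ˡ (∈-++⁺ʳ (map (_⟼ₐ s) (upTo s))
                    (∈-++⁺ʳ (map (s ⟼ₐ_) (upTo s)) (∈-map⁺ (_≐ₐ s) (∈-upTo⁺ x<y)))))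
... | inj₁ y<s  = ∈-++⁺ʳ (freshAtoms s) (∈-atoms⁺ (eq< x<y y<s))

∈-atoms⁻ : ∀ {s α} → α ∈ atoms s → Below s α
∈-atoms⁻ {suc s} α∈ with ∈-++⁻ (freshAtoms s) α∈
... | inj₂ α∈′ = Below-suc (∈-atoms⁻ α∈′)
... | inj₁ (here refl) = arc< (n<1+n s) (n<1+n s)
... | inj₁ (there α∈′) with ∈-++⁻ (map (_⟼ₐ s) (upTo s)) α∈′
...   | inj₁ p with _ , x∈ , refl ← ∈-map⁻ (_⟼ₐ s) p = arc< (m<n⇒m<1+n (∈-upTo⁻ x∈)) (n<1+n s)
...   | inj₂ p with ∈-++⁻ (map (s ⟼ₐ_) (upTo s)) p
...     | inj₁ q with _ , y∈ , refl ← ∈-map⁻ (s ⟼ₐ_) q = arc< (n<1+n s) (m<n⇒m<1+n (∈-upTo⁻ y∈))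
...     | inj₂ q with _ , x∈ , refl ← ∈-map⁻ (_≐ₐ s) q = eq< (∈-upTo⁻ x∈) (n<1+n s)

Below⇒Occurs< : ∀ {s α z} → Below s α → Occurs z (atom α) → z < s
Below⇒Occurs< (arc< x<s y<s) (inj₁ refl) = x<s
Below⇒Occurs< (arc< x<s y<s) (inj₂ refl) = y<s
Below⇒Occurs< (eq< x<y y<s)  (inj₁ refl) = <-trans x<y y<s
Below⇒Occurs< (eq< x<y y<s)  (inj₂ refl) = y<s

length-atoms : ∀ s → length (atoms (suc s)) ≡ suc (s + (s + s)) + length (atoms s)
length-atoms s = trans (length-++ (freshAtoms s)) (cong (_+ length (atoms s)) length-freshAtoms)
  where
  length-upTo′ : (f : ℕ → Atom) → length (map f (upTo s)) ≡ s
  length-upTo′ f = trans (length-map f (upTo s)) (length-upTo s)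
  length-freshAtoms : length (freshAtoms s) ≡ suc (s + (s + s))
  length-freshAtoms = cong suc (trans (length-++ (map (_⟼ₐ s) (upTo s)))
    (cong₂ _+_ (length-upTo′ (_⟼ₐ s)) (trans (length-++ (map (s ⟼ₐ_) (upTo s)))
      (cong₂ _+_ (length-upTo′ (s ⟼ₐ_)) (length-upTo′ (_≐ₐ s))))))

-- A nonempty set of quantifier strings of length r.
data Trie : ℕ → Set where
  leaf : Trie 0
  ∃ᵗ   : ∀ {r} → Trie r → Trie (suc r)
  ∀ᵗ   : ∀ {r} → Trie r → Trie (suc r)
  ∃∀ᵗ  : ∀ {r} → Trie r → Trie r → Trie (suc r)

infix 4 _∈ᵗ_ _∈ᵐ_

_∈ᵗ_ : ∀ {r} → List Quant → Trie r → Set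
[]          ∈ᵗ leaf      = ⊤
(∃q ∷ qs)   ∈ᵗ ∃ᵗ e      = qs ∈ᵗ e
(∀q ∷ qs)   ∈ᵗ ∀ᵗ a      = qs ∈ᵗ a
(∃q ∷ qs)   ∈ᵗ ∃∀ᵗ e a   = qs ∈ᵗ e
(∀q ∷ qs)   ∈ᵗ ∃∀ᵗ e a   = qs ∈ᵗ a
_           ∈ᵗ _         = ⊥

_∪_ : ∀ {r} → Trie r → Trie r → Trie r
leaf      ∪ leaf      = leaf
∃ᵗ e      ∪ ∃ᵗ e′     = ∃ᵗ (e ∪ e′)
∃ᵗ e      ∪ ∀ᵗ a′     = ∃∀ᵗ e a′
∃ᵗ e      ∪ ∃∀ᵗ e′ a′ = ∃∀ᵗ (e ∪ e′) a′
∀ᵗ a      ∪ ∃ᵗ e′     = ∃∀ᵗ e′ a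
∀ᵗ a      ∪ ∀ᵗ a′     = ∀ᵗ (a ∪ a′)
∀ᵗ a      ∪ ∃∀ᵗ e′ a′ = ∃∀ᵗ e′ (a ∪ a′)
∃∀ᵗ e a   ∪ ∃ᵗ e′     = ∃∀ᵗ (e ∪ e′) a
∃∀ᵗ e a   ∪ ∀ᵗ a′     = ∃∀ᵗ e (a ∪ a′)
∃∀ᵗ e a   ∪ ∃∀ᵗ e′ a′ = ∃∀ᵗ (e ∪ e′) (a ∪ a′)

∈-∪⁺ˡ : ∀ {r} (t u : Trie r) qs → qs ∈ᵗ t → qs ∈ᵗ t ∪ u
∈-∪⁺ˡ leaf      leaf        qs        p = p
∈-∪⁺ˡ (∃ᵗ e)    (∃ᵗ e′)     (∃q ∷ qs) p = ∈-∪⁺ˡ e e′ qs p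
∈-∪⁺ˡ (∃ᵗ e)    (∀ᵗ a′)     (∃q ∷ qs) p = p
∈-∪⁺ˡ (∃ᵗ e)    (∃∀ᵗ e′ a′) (∃q ∷ qs) p = ∈-∪⁺ˡ e e′ qs p
∈-∪⁺ˡ (∀ᵗ a)    (∃ᵗ e′)     (∀q ∷ qs) p = p
∈-∪⁺ˡ (∀ᵗ a)    (∀ᵗ a′)     (∀q ∷ qs) p = ∈-∪⁺ˡ a a′ qs p
∈-∪⁺ˡ (∀ᵗ a)    (∃∀ᵗ e′ a′) (∀q ∷ qs) p = ∈-∪⁺ˡ a a′ qs p
∈-∪⁺ˡ (∃∀ᵗ e a) (∃ᵗ e′)     (∃q ∷ qs) p = ∈-∪⁺ˡ e e′ qs p
∈-∪⁺ˡ (∃∀ᵗ e a) (∃ᵗ e′)     (∀q ∷ qs) p = p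
∈-∪⁺ˡ (∃∀ᵗ e a) (∀ᵗ a′)     (∃q ∷ qs) p = p
∈-∪⁺ˡ (∃∀ᵗ e a) (∀ᵗ a′)     (∀q ∷ qs) p = ∈-∪⁺ˡ a a′ qs p
∈-∪⁺ˡ (∃∀ᵗ e a) (∃∀ᵗ e′ a′) (∃q ∷ qs) p = ∈-∪⁺ˡ e e′ qs p
∈-∪⁺ˡ (∃∀ᵗ e a) (∃∀ᵗ e′ a′) (∀q ∷ qs) p = ∈-∪⁺ˡ a a′ qs p

∈-∪⁺ʳ : ∀ {r} (t u : Trie r) qs → qs ∈ᵗ u → qs ∈ᵗ t ∪ u
∈-∪⁺ʳ leaf      leaf        qs        p = p
∈-∪⁺ʳ (∃ᵗ e)    (∃ᵗ e′)     (∃q ∷ qs) p = ∈-∪⁺ʳ e e′ qs p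
∈-∪⁺ʳ (∃ᵗ e)    (∀ᵗ a′)     (∀q ∷ qs) p = p
∈-∪⁺ʳ (∃ᵗ e)    (∃∀ᵗ e′ a′) (∃q ∷ qs) p = ∈-∪⁺ʳ e e′ qs p
∈-∪⁺ʳ (∃ᵗ e)    (∃∀ᵗ e′ a′) (∀q ∷ qs) p = p
∈-∪⁺ʳ (∀ᵗ a)    (∃ᵗ e′)     (∃q ∷ qs) p = p
∈-∪⁺ʳ (∀ᵗ a)    (∀ᵗ a′)     (∀q ∷ qs) p = ∈-∪⁺ʳ a a′ qs p
∈-∪⁺ʳ (∀ᵗ a)    (∃∀ᵗ e′ a′) (∃q ∷ qs) p = p
∈-∪⁺ʳ (∀ᵗ a)    (∃∀ᵗ e′ a′) (∀q ∷ qs) p = ∈-∪⁺ʳ a a′ qs p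
∈-∪⁺ʳ (∃∀ᵗ e a) (∃ᵗ e′)     (∃q ∷ qs) p = ∈-∪⁺ʳ e e′ qs p
∈-∪⁺ʳ (∃∀ᵗ e a) (∀ᵗ a′)     (∀q ∷ qs) p = ∈-∪⁺ʳ a a′ qs p
∈-∪⁺ʳ (∃∀ᵗ e a) (∃∀ᵗ e′ a′) (∃q ∷ qs) p = ∈-∪⁺ʳ e e′ qs p
∈-∪⁺ʳ (∃∀ᵗ e a) (∃∀ᵗ e′ a′) (∀q ∷ qs) p = ∈-∪⁺ʳ a a′ qs p

∈-∪⁻ : ∀ {r} (t u : Trie r) qs → qs ∈ᵗ t ∪ u → qs ∈ᵗ t ⊎ qs ∈ᵗ u
∈-∪⁻ leaf      leaf        qs        p = inj₁ p
∈-∪⁻ (∃ᵗ e)    (∃ᵗ e′)     (∃q ∷ qs) p = ∈-∪⁻ e e′ qs p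
∈-∪⁻ (∃ᵗ e)    (∀ᵗ a′)     (∃q ∷ qs) p = inj₁ p
∈-∪⁻ (∃ᵗ e)    (∀ᵗ a′)     (∀q ∷ qs) p = inj₂ p
∈-∪⁻ (∃ᵗ e)    (∃∀ᵗ e′ a′) (∃q ∷ qs) p = ∈-∪⁻ e e′ qs p
∈-∪⁻ (∃ᵗ e)    (∃∀ᵗ e′ a′) (∀q ∷ qs) p = inj₂ p
∈-∪⁻ (∀ᵗ a)    (∃ᵗ e′)     (∃q ∷ qs) p = inj₂ p
∈-∪⁻ (∀ᵗ a)    (∃ᵗ e′)     (∀q ∷ qs) p = inj₁ p
∈-∪⁻ (∀ᵗ a)    (∀ᵗ a′)     (∀q ∷ qs) p = ∈-∪⁻ a a′ qs p
∈-∪⁻ (∀ᵗ a)    (∃∀ᵗ e′ a′) (∃q ∷ qs) p = inj₂ p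
∈-∪⁻ (∀ᵗ a)    (∃∀ᵗ e′ a′) (∀q ∷ qs) p = ∈-∪⁻ a a′ qs p
∈-∪⁻ (∃∀ᵗ e a) (∃ᵗ e′)     (∃q ∷ qs) p = ∈-∪⁻ e e′ qs p
∈-∪⁻ (∃∀ᵗ e a) (∃ᵗ e′)     (∀q ∷ qs) p = inj₁ p
∈-∪⁻ (∃∀ᵗ e a) (∀ᵗ a′)     (∃q ∷ qs) p = inj₁ p
∈-∪⁻ (∃∀ᵗ e a) (∀ᵗ a′)     (∀q ∷ qs) p = ∈-∪⁻ a a′ qs p
∈-∪⁻ (∃∀ᵗ e a) (∃∀ᵗ e′ a′) (∃q ∷ qs) p = ∈-∪⁻ e e′ qs p
∈-∪⁻ (∃∀ᵗ e a) (∃∀ᵗ e′ a′) (∀q ∷ qs) p = ∈-∪⁻ a a′ qs p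

_∈ᵐ_ : ∀ {r} → List Quant → Maybe (Trie r) → Set
qs ∈ᵐ nothing = ⊥
qs ∈ᵐ just t  = qs ∈ᵗ t

_∪ᵐ_ : ∀ {r} → Maybe (Trie r) → Maybe (Trie r) → Maybe (Trie r)
nothing ∪ᵐ m       = m
just t  ∪ᵐ nothing = just t
just t  ∪ᵐ just u  = just (t ∪ u)

∈-∪ᵐ⁺ˡ : ∀ {r} (m n : Maybe (Trie r)) qs → qs ∈ᵐ m → qs ∈ᵐ m ∪ᵐ n
∈-∪ᵐ⁺ˡ (just t) nothing  qs p = p
∈-∪ᵐ⁺ˡ (just t) (just u) qs p = ∈-∪⁺ˡ t u qs p

∈-∪ᵐ⁺ʳ : ∀ {r} (m n : Maybe (Trie r)) qs → qs ∈ᵐ n → qs ∈ᵐ m ∪ᵐ n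
∈-∪ᵐ⁺ʳ nothing  n        qs p = p
∈-∪ᵐ⁺ʳ (just t) (just u) qs p = ∈-∪⁺ʳ t u qs p

∈-∪ᵐ⁻ : ∀ {r} (m n : Maybe (Trie r)) qs → qs ∈ᵐ m ∪ᵐ n → qs ∈ᵐ m ⊎ qs ∈ᵐ n
∈-∪ᵐ⁻ nothing  n        qs p = inj₂ p
∈-∪ᵐ⁻ (just t) nothing  qs p = inj₁ p
∈-∪ᵐ⁻ (just t) (just u) qs p = ∈-∪⁻ t u qs p

leafTrie : (r : ℕ) → Maybe (Trie r)
leafTrie zero    = just leaf
leafTrie (suc r) = nothing

-- Paths whose length is not r contribute nothing.
prefixTrie : (r : ℕ) → Formula → Maybe (Trie r)
prefixTrie r       (x ≐ y)    = leafTrie r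
prefixTrie r       (x ⟼ y)    = leafTrie r
prefixTrie r       (¬' A)     = prefixTrie r A
prefixTrie r       (A ∧' B)   = prefixTrie r A ∪ᵐ prefixTrie r B
prefixTrie r       (A ∨' B)   = prefixTrie r A ∪ᵐ prefixTrie r B
prefixTrie zero    (Q q x A)  = nothing
prefixTrie (suc r) (Q ∃q x A) = Data.Maybe.map ∃ᵗ (prefixTrie r A)
prefixTrie (suc r) (Q ∀q x A) = Data.Maybe.map ∀ᵗ (prefixTrie r A)

prefixTrie-complete : ∀ {A π} → Path A π → map proj₁ π ∈ᵐ prefixTrie (length π) A
prefixTrie-complete (p≐ x y) = tt
prefixTrie-complete (p⟼ x y) = tt
prefixTrie-complete (p¬ p)   = prefixTrie-complete p
prefixTrie-complete {A ∧' B} {π} (p∧ˡ p) = ∈-∪ᵐ⁺ˡ (prefixTrie (length π) A) _ _ (prefixTrie-complete p)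
prefixTrie-complete {A ∧' B} {π} (p∧ʳ p) = ∈-∪ᵐ⁺ʳ (prefixTrie (length π) A) _ _ (prefixTrie-complete p)
prefixTrie-complete {A ∨' B} {π} (p∨ˡ p) = ∈-∪ᵐ⁺ˡ (prefixTrie (length π) A) _ _ (prefixTrie-complete p)
prefixTrie-complete {A ∨' B} {π} (p∨ʳ p) = ∈-∪ᵐ⁺ʳ (prefixTrie (length π) A) _ _ (prefixTrie-complete p)
prefixTrie-complete (pQ {∃q} {A = A} {π} p) with prefixTrie (length π) A | prefixTrie-complete p
... | just t | i = i
prefixTrie-complete (pQ {∀q} {A = A} {π} p) with prefixTrie (length π) A | prefixTrie-complete p
... | just t | i = i

prefixTrie-sound : ∀ r A qs → qs ∈ᵐ prefixTrie r A → ∃[ π ] Path A π × map proj₁ π ≡ qs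
prefixTrie-sound zero    (x ≐ y) [] _ = [] , p≐ x y , refl
prefixTrie-sound zero    (x ⟼ y) [] _ = [] , p⟼ x y , refl
prefixTrie-sound zero    (x ≐ y) (∃q ∷ _) ()
prefixTrie-sound zero    (x ≐ y) (∀q ∷ _) ()
prefixTrie-sound zero    (x ⟼ y) (∃q ∷ _) ()
prefixTrie-sound zero    (x ⟼ y) (∀q ∷ _) ()
prefixTrie-sound r       (¬' A)  qs i with π , p , refl ← prefixTrie-sound r A qs i = π , p¬ p , refl
prefixTrie-sound r (A ∧' B) qs i with ∈-∪ᵐ⁻ (prefixTrie r A) (prefixTrie r B) qs i
... | inj₁ j with π , p , refl ← prefixTrie-sound r A qs j = π , p∧ˡ p , refl
... | inj₂ j with π , p , refl ← prefixTrie-sound r B qs j = π , p∧ʳ p , refl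
prefixTrie-sound r (A ∨' B) qs i with ∈-∪ᵐ⁻ (prefixTrie r A) (prefixTrie r B) qs i
... | inj₁ j with π , p , refl ← prefixTrie-sound r A qs j = π , p∨ˡ p , refl
... | inj₂ j with π , p , refl ← prefixTrie-sound r B qs j = π , p∨ʳ p , refl
prefixTrie-sound (suc r) (Q ∃q x A) qs i with prefixTrie r A | prefixTrie-sound r A
prefixTrie-sound (suc r) (Q ∃q x A) (∃q ∷ qs) i | just t | ih
  with π , p , refl ← ih qs i = (∃q , x) ∷ π , pQ p , refl
prefixTrie-sound (suc r) (Q ∀q x A) qs i with prefixTrie r A | prefixTrie-sound r A
prefixTrie-sound (suc r) (Q ∀q x A) (∀q ∷ qs) i | just t | ih
  with π , p , refl ← ih qs i = (∀q , x) ∷ π , pQ p , refl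

PathsIn : ∀ {r} → Trie r → ℕ → Formula → Set
PathsIn {r} t s A = ∀ π → Path A π → map proj₂ π ≡ range s r × map proj₁ π ∈ᵗ t

OccursBelow : ℕ → Formula → Set
OccursBelow n A = ∀ z → Occurs z A → z < n

PathsIn-atom : ∀ {s} α → PathsIn leaf s (atom α)
PathsIn-atom (x ≐ₐ y) _ (p≐ x y) = refl , tt
PathsIn-atom (x ⟼ₐ y) _ (p⟼ x y) = refl , tt

PathsIn-∧ : ∀ {r} {t : Trie r} {s A B} → PathsIn t s A → PathsIn t s B → PathsIn t s (A ∧' B)
PathsIn-∧ pa pb π (p∧ˡ p) = pa π p
PathsIn-∧ pa pb π (p∧ʳ p) = pb π p

PathsIn-∨ : ∀ {r} {t : Trie r} {s A B} → PathsIn t s A → PathsIn t s B → PathsIn t s (A ∨' B)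
PathsIn-∨ pa pb π (p∨ˡ p) = pa π p
PathsIn-∨ pa pb π (p∨ʳ p) = pb π p

PathsIn-∃ : ∀ {r} {e : Trie r} {s A} → PathsIn e (suc s) A → PathsIn (∃ᵗ e) s (Q ∃q s A)
PathsIn-∃ pa _ (pQ p) = Data.Product.map₁ (cong (_ ∷_)) (pa _ p)

PathsIn-∀ : ∀ {r} {a : Trie r} {s A} → PathsIn a (suc s) A → PathsIn (∀ᵗ a) s (Q ∀q s A)
PathsIn-∀ pa _ (pQ p) = Data.Product.map₁ (cong (_ ∷_)) (pa _ p)

PathsIn-Q : ∀ {r} {t : Trie (suc r)} {s q x A} → PathsIn t s (Q q x A) → x ≡ s × ∃[ qs ] (q ∷ qs) ∈ᵗ t
PathsIn-Q {A = A} paths with π , p ← somePath A with vars , qs∈ ← paths _ (pQ p) = ∷-injectiveˡ vars , _ , qs∈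

PathsIn-Q⁻ : ∀ {r} {t : Trie (suc r)} {u : Trie r} {s q A} → (∀ {qs} → (q ∷ qs) ∈ᵗ t → qs ∈ᵗ u) →
             PathsIn t s (Q q s A) → PathsIn u (suc s) A
PathsIn-Q⁻ sub paths π p with vars , qs∈ ← paths _ (pQ p) = ∷-injectiveʳ vars , sub qs∈

PathsIn-leaf-Q : ∀ {s q x A} → ¬ PathsIn leaf s (Q q x A)
PathsIn-leaf-Q {A = A} paths with π , p ← somePath A with () ← proj₁ (paths _ (pQ p))

PathsIn-atom⁻ : ∀ {r} {t : Trie (suc r)} {s} α → ¬ PathsIn t s (atom α)
PathsIn-atom⁻ (x ≐ₐ y) paths with () ← proj₁ (paths [] (p≐ x y))
PathsIn-atom⁻ (x ⟼ₐ y) paths with () ← proj₁ (paths [] (p⟼ x y))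

OccursBelow-Q : ∀ {r s} q A → OccursBelow (s + suc r) (Q q s A) → OccursBelow (suc s + r) A
OccursBelow-Q {r} {s} q A occ z o = subst (z <_) (+-suc s r) (occ z (inj₂ o))

signs : List Atom → List (List Formula)
signs []       = [] ∷ []
signs (α ∷ αs) = cartesianProductWith _∷_ (atom α ∷ ¬' atom α ∷ []) (signs αs)

length-signs : ∀ αs → length (signs αs) ≡ 2 ^ length αs
length-signs []       = refl
length-signs (α ∷ αs) = trans (length-cartesianProductWith _∷_ (atom α ∷ ¬' atom α ∷ []) (signs αs))
                              (cong (2 *_) (length-signs αs))

-- Every Hintikka formula of shape t over x₀ … x₍ₛ₋₁₎ occurs in this list, whatever the digraph.
candidates : ∀ {r} → Trie r → ℕ → List Formula
candidates leaf      s = map ⋀ (signs (atoms s))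
candidates (∃ᵗ e)    s = map (⋀∃ s) (sublists (candidates e (suc s)))
candidates (∀ᵗ a)    s = map (∀⋁ s) (sublists (candidates a (suc s)))
candidates (∃∀ᵗ e a) s = cartesianProductWith _∧'_ (map (⋀∃ s) (sublists (candidates e (suc s))))
                                                   (map (∀⋁ s) (sublists (candidates a (suc s))))

L-⋀∃ : ∀ s {ℓ} Φs → All (λ φ → L φ ≤ ℓ) Φs → L (⋀∃ s Φs) ≤ 3 + length Φs * (ℓ + 5)
L-⋀∃ s {ℓ} Φs bounded = begin
  L (⋀ (map (Q ∃q s) Φs))                     ≤⟨ L-⋀ (λ _ _ → refl) (map (Q ∃q s) Φs)
                                                    (All.map⁺ (All.map (λ b → s≤s (s≤s b)) bounded)) ⟩
  3 + length (map (Q ∃q s) Φs) * (2 + ℓ + 3)   ≡⟨ cong₂ (λ n k → 3 + n * k) (length-map (Q ∃q s) Φs)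
                                                         (regroup ℓ) ⟩
  3 + length Φs * (ℓ + 5)                      ∎
  where
  open ≤-Reasoning
  regroup : ∀ ℓ → 2 + ℓ + 3 ≡ ℓ + 5
  regroup = solve-∀

L-∀⋁ : ∀ s {ℓ} Φs → All (λ φ → L φ ≤ ℓ) Φs → L (∀⋁ s Φs) ≤ 5 + length Φs * (ℓ + 3)
L-∀⋁ s Φs bounded = s≤s (s≤s (L-⋁ (λ _ _ → refl) Φs bounded))

-- 2 ^ countExp M r bounds the number of candidates of rank r when there are M atoms.
countExp : ℕ → ℕ → ℕ
countExp M zero    = M
countExp M (suc r) = 2 ^ suc (countExp M r)

lengthBound : ℕ → ℕ → ℕ
lengthBound M zero    = 3 + M * 7
lengthBound M (suc r) = 11 + 2 * (2 ^ countExp M r * (lengthBound M r + 5))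

length-map-sublists : ∀ {A B : Set} (f : List A → B) xs → length (map f (sublists xs)) ≡ 2 ^ length xs
length-map-sublists f xs = trans (length-map f (sublists xs)) (length-sublists xs)

length-map-sublists≤ : ∀ {A B : Set} (f : List A → B) xs {c} → length xs ≤ 2 ^ c →
                       length (map f (sublists xs)) ≤ 2 ^ (2 ^ suc c)
length-map-sublists≤ f xs {c} xs≤ = begin
  length (map f (sublists xs))   ≡⟨ length-map-sublists f xs ⟩
  2 ^ length xs                  ≤⟨ ^-monoʳ-≤ 2 xs≤ ⟩
  2 ^ (2 ^ c)                    ≤⟨ ^-monoʳ-≤ 2 (^-monoʳ-≤ 2 (n≤1+n c)) ⟩
  2 ^ (2 ^ suc c)                ∎
  where open ≤-Reasoning

length-candidates : ∀ {r} (t : Trie r) s {n} → r + s ≡ n →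
                    length (candidates t s) ≤ 2 ^ countExp (length (atoms n)) r
length-candidates leaf s refl =
  ≤-reflexive (trans (length-map ⋀ (signs (atoms s))) (length-signs (atoms s)))
length-candidates (∃ᵗ {r} e) s {n} eq = length-map-sublists≤ (⋀∃ s) (candidates e (suc s))
  {countExp (length (atoms n)) r} (length-candidates e (suc s) (trans (+-suc r s) eq))
length-candidates (∀ᵗ {r} a) s {n} eq = length-map-sublists≤ (∀⋁ s) (candidates a (suc s))
  {countExp (length (atoms n)) r} (length-candidates a (suc s) (trans (+-suc r s) eq))
length-candidates (∃∀ᵗ {r} e a) s {n} eq = begin
  length (cartesianProductWith _∧'_ (map (⋀∃ s) (sublists Cₑ)) (map (∀⋁ s) (sublists Cₐ)))
    ≡⟨ length-cartesianProductWith _∧'_ (map (⋀∃ s) (sublists Cₑ)) (map (∀⋁ s) (sublists Cₐ)) ⟩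
  length (map (⋀∃ s) (sublists Cₑ)) * length (map (∀⋁ s) (sublists Cₐ))
    ≡⟨ cong₂ _*_ (length-map-sublists (⋀∃ s) Cₑ) (length-map-sublists (∀⋁ s) Cₐ) ⟩
  2 ^ length Cₑ * 2 ^ length Cₐ
    ≡⟨ ^-distribˡ-+-* 2 (length Cₑ) (length Cₐ) ⟨
  2 ^ (length Cₑ + length Cₐ)
    ≤⟨ ^-monoʳ-≤ 2 (+-mono-≤ (length-candidates e (suc s) eq′) (length-candidates a (suc s) eq′)) ⟩
  2 ^ (2 ^ c + 2 ^ c)
    ≡⟨ cong (λ k → 2 ^ (2 ^ c + k)) (+-identityʳ (2 ^ c)) ⟨
  2 ^ (2 ^ suc c) ∎
  where
  open ≤-Reasoning
  c : ℕ
  c = countExp (length (atoms n)) r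
  Cₑ Cₐ : List Formula
  Cₑ = candidates e (suc s)
  Cₐ = candidates a (suc s)
  eq′ : r + suc s ≡ n
  eq′ = trans (+-suc r s) eq

0<+suc : ∀ r s → 0 < r + suc s
0<+suc r s = <-≤-trans (s≤s z≤n) (m≤n+m (suc s) r)

module Hintikka (G : Digraph) where

  sat-atom? : ∀ σ α → Dec (Sat G σ (atom α))
  sat-atom? σ (x ≐ₐ y) = σ x Fin.≟ σ y
  sat-atom? σ (x ⟼ₐ y) = arc G (σ x) (σ y) Data.Bool.≟ true

  literal : Assignment G → Atom → Formula
  literal σ α with sat-atom? σ α
  ... | yes _ = atom α
  ... | no  _ = ¬' atom α

  diagram : ℕ → Assignment G → Formula
  diagram s σ = ⋀ (map (literal σ) (atoms s))

  hintikka   : ∀ {r} → Trie r → ℕ → Assignment G → Formula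
  successor? : ∀ {r} (t : Trie r) s σ φ → Dec (∃[ v ] hintikka t (suc s) (update G σ s v) ≡ φ)
  -- The distinct formulas hintikka t (1 + s) σ[s ↦ v]; listing them as a sublist of the
  -- candidates bounds their number independently of G.
  successors : ∀ {r} → Trie r → ℕ → Assignment G → List Formula

  hintikka leaf      s σ = diagram s σ
  hintikka (∃ᵗ e)    s σ = ⋀∃ s (successors e s σ)
  hintikka (∀ᵗ a)    s σ = ∀⋁ s (successors a s σ)
  hintikka (∃∀ᵗ e a) s σ = ⋀∃ s (successors e s σ) ∧' ∀⋁ s (successors a s σ)

  successor? t s σ φ = any? λ v → hintikka t (suc s) (update G σ s v) ≟ᶠ φ

  successors t s σ = filter (successor? t s σ) (candidates t (suc s))

  literal-elim : ∀ (P : Formula → Set) σ α → P (atom α) → P (¬' atom α) → P (literal σ α)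
  literal-elim P σ α p n with sat-atom? σ α
  ... | yes _ = p
  ... | no  _ = n

  literal-holds : ∀ σ α → Sat G σ (literal σ α)
  literal-holds σ α with sat-atom? σ α
  ... | yes s = s
  ... | no ¬s = ¬s

  literal-transfer : ∀ {G′} {σ′ : Assignment G′} σ α →
                     Sat G′ σ′ (literal σ α) → Sat G σ (atom α) ⇔ Sat G′ σ′ (atom α)
  literal-transfer σ α h with sat-atom? σ α
  ... | yes s = mk⇔ (λ _ → h) (λ _ → s)
  ... | no ¬s = mk⇔ (⊥-elim ∘ ¬s) (⊥-elim ∘ h)

  literals∈signs : ∀ σ αs → map (literal σ) αs ∈ signs αs
  literals∈signs σ []       = here refl
  literals∈signs σ (α ∷ αs) = ∈-cartesianProductWith⁺ _∷_
    (literal-elim (_∈ atom α ∷ ¬' atom α ∷ []) σ α (here refl) (there (here refl)))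
    (literals∈signs σ αs)

  All⇒diagram : ∀ (P : Formula → Set) → (∀ {A B} → P A → P B → P (A ∧' B)) →
                ∀ {s} σ → 0 < s → (∀ {α} → Below s α → P (literal σ α)) → P (diagram s σ)
  All⇒diagram P step {suc s} σ _ p =
    All⇒⋀ P step (∈-map⁺ (literal σ) (∈-atoms⁺ (arc< (s≤s z≤n) (s≤s z≤n))))
               (All.map⁺ (All.tabulate (p ∘ ∈-atoms⁻)))

  diagram-transfer : ∀ {G′} {σ′ : Assignment G′} {s} σ α → Sat G′ σ′ (diagram s σ) →
                     OccursBelow s (atom α) → Sat G σ (atom α) ⇔ Sat G′ σ′ (atom α)
  diagram-transfer {G′} {σ′} {s} σ α h occ = transfer α occ
    where
    listed : ∀ {β} → Below s β → Sat G σ (atom β) ⇔ Sat G′ σ′ (atom β)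
    listed b = literal-transfer σ _ (All.lookup (⋀⇒All (Sat G′ σ′) (λ p → p) (map (literal σ) (atoms s)) h)
                                                (∈-map⁺ (literal σ) (∈-atoms⁺ b)))
    transfer : ∀ α → OccursBelow s (atom α) → Sat G σ (atom α) ⇔ Sat G′ σ′ (atom α)
    transfer (x ⟼ₐ y) occ = listed (arc< (occ x (inj₁ refl)) (occ y (inj₂ refl)))
    transfer (x ≐ₐ y) occ with <-cmp x y
    ... | tri< x<y _ _ = listed (eq< x<y (occ y (inj₂ refl)))
    ... | tri≈ _ refl _ = mk⇔ (λ _ → refl) (λ _ → refl)
    ... | tri> _ _ y<x = let y≐x = listed (eq< y<x (occ x (inj₁ refl))) in
      mk⇔ (sym ∘ Equivalence.to y≐x ∘ sym) (sym ∘ Equivalence.from y≐x ∘ sym)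

  hintikka∈candidates : ∀ {r} (t : Trie r) s σ → hintikka t s σ ∈ candidates t s
  hintikka∈candidates leaf      s σ = ∈-map⁺ ⋀ (literals∈signs σ (atoms s))
  hintikka∈candidates (∃ᵗ e)    s σ =
    ∈-map⁺ (⋀∃ s) (filter∈sublists (successor? e s σ) (candidates e (suc s)))
  hintikka∈candidates (∀ᵗ a)    s σ =
    ∈-map⁺ (∀⋁ s) (filter∈sublists (successor? a s σ) (candidates a (suc s)))
  hintikka∈candidates (∃∀ᵗ e a) s σ = ∈-cartesianProductWith⁺ _∧'_
    (∈-map⁺ (⋀∃ s) (filter∈sublists (successor? e s σ) (candidates e (suc s))))
    (∈-map⁺ (∀⋁ s) (filter∈sublists (successor? a s σ) (candidates a (suc s))))

  successor∈ : ∀ {r} (t : Trie r) s σ v → hintikka t (suc s) (update G σ s v) ∈ successors t s σ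
  successor∈ t s σ v = ∈-filter⁺ (successor? t s σ) (hintikka∈candidates t (suc s) _) (v , refl)

  ∈-successors⁻ : ∀ {r} (t : Trie r) s σ {φ} → φ ∈ successors t s σ →
                  ∃[ v ] hintikka t (suc s) (update G σ s v) ≡ φ
  ∈-successors⁻ t s σ p = proj₂ (∈-filter⁻ (successor? t s σ) {xs = candidates t (suc s)} p)

  hintikka-holds : ∀ {r} (t : Trie r) s σ → 0 < r + s → Sat G σ (hintikka t s σ)
  ∃-holds : ∀ {r} (e : Trie r) s σ → Sat G σ (⋀∃ s (successors e s σ))
  ∀-holds : ∀ {r} (a : Trie r) s σ → Sat G σ (∀⋁ s (successors a s σ))

  hintikka-holds leaf      s σ 0<s = All⇒diagram (Sat G σ) _,_ σ 0<s (λ {α} _ → literal-holds σ α)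
  hintikka-holds (∃ᵗ e)    s σ _   = ∃-holds e s σ
  hintikka-holds (∀ᵗ a)    s σ _   = ∀-holds a s σ
  hintikka-holds (∃∀ᵗ e a) s σ _   = ∃-holds e s σ , ∀-holds a s σ

  ∃-holds {r} e s σ = ⋀∃⁺ (successor∈ e s σ Fin.zero) λ ψ∈ →
    let v , eq = ∈-successors⁻ e s σ ψ∈ in
    v , subst (Sat G _) eq (hintikka-holds e (suc s) _ (0<+suc r s))
  ∀-holds {r} a s σ = ∀⋁⁺ λ w → _ , successor∈ a s σ w , hintikka-holds a (suc s) _ (0<+suc r s)

  module _ (P : ∀ {r} → Trie r → ℕ → Formula → Set)
           (P-leaf : ∀ {s} σ → 0 < s → P leaf s (diagram s σ))
           (P-∃ : ∀ {r s} {e : Trie r} {φ Φs} → φ ∈ Φs → All (P e (suc s)) Φs → P (∃ᵗ e) s (⋀∃ s Φs))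
           (P-∀ : ∀ {r s} {a : Trie r} {φ Φs} → φ ∈ Φs → All (P a (suc s)) Φs → P (∀ᵗ a) s (∀⋁ s Φs))
           (P-∃∀ : ∀ {r s} {e a : Trie r} {φ ψ} → P (∃ᵗ e) s φ → P (∀ᵗ a) s ψ → P (∃∀ᵗ e a) s (φ ∧' ψ))
           where

    hintikka-induction : ∀ {r} (t : Trie r) s σ → 0 < r + s → P t s (hintikka t s σ)
    all-successors : ∀ {r} (t : Trie r) s σ → All (P t (suc s)) (successors t s σ)

    hintikka-induction leaf      s σ 0<s = P-leaf σ 0<s
    hintikka-induction (∃ᵗ e)    s σ _   = P-∃ (successor∈ e s σ Fin.zero) (all-successors e s σ)
    hintikka-induction (∀ᵗ a)    s σ _   = P-∀ (successor∈ a s σ Fin.zero) (all-successors a s σ)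
    hintikka-induction (∃∀ᵗ e a) s σ _   =
      P-∃∀ (P-∃ (successor∈ e s σ Fin.zero) (all-successors e s σ))
           (P-∀ (successor∈ a s σ Fin.zero) (all-successors a s σ))

    all-successors {r} t s σ = All.tabulate λ φ∈ →
      let _ , eq = ∈-successors⁻ t s σ φ∈ in
      subst (P t (suc s)) eq (hintikka-induction t (suc s) _ (0<+suc r s))

  hintikka-rank : ∀ {r} (t : Trie r) s σ → 0 < r + s → D (hintikka t s σ) ≡ r
  hintikka-rank = hintikka-induction (λ {r} _ _ φ → D φ ≡ r)
    (λ σ 0<s → All⇒diagram (rank 0) ⊔-≡ σ 0<s λ {α} _ →
      literal-elim (rank 0) σ α (rank-atom α) (rank-atom α))
    (λ {r} φ∈ ranks → All⇒⋀ (rank (suc r)) ⊔-≡ (∈-map⁺ _ φ∈) (All.map⁺ (All.map (cong suc) ranks)))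
    (λ {r} φ∈ ranks → cong suc (All⇒⋁ (rank r) ⊔-≡ φ∈ ranks))
    ⊔-≡
    where
    rank : ℕ → Formula → Set
    rank k φ = D φ ≡ k
    ⊔-≡ : ∀ {k m n} → m ≡ k → n ≡ k → m ⊔ n ≡ k
    ⊔-≡ refl refl = ⊔-idem _
    rank-atom : ∀ α → D (atom α) ≡ 0
    rank-atom (x ≐ₐ y) = refl
    rank-atom (x ⟼ₐ y) = refl

  hintikka-nnf : ∀ {r} (t : Trie r) s σ → 0 < r + s → NNF (hintikka t s σ)
  hintikka-nnf = hintikka-induction (λ _ _ → NNF)
    (λ σ 0<s → All⇒diagram NNF and σ 0<s λ {α} _ → literal-elim NNF σ α (nnf-atom α) (nnf-¬atom α))
    (λ φ∈ nnfs → All⇒⋀ NNF and (∈-map⁺ _ φ∈) (All.map⁺ (All.map quant nnfs)))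
    (λ φ∈ nnfs → quant (All⇒⋁ NNF or φ∈ nnfs))
    and
    where
    nnf-atom : ∀ α → NNF (atom α)
    nnf-atom (x ≐ₐ y) = atom≐ x y
    nnf-atom (x ⟼ₐ y) = atom⟼ x y
    nnf-¬atom : ∀ α → NNF (¬' atom α)
    nnf-¬atom (x ≐ₐ y) = neg≐ x y
    nnf-¬atom (x ⟼ₐ y) = neg⟼ x y

  hintikka-free : ∀ {r} (t : Trie r) s σ → 0 < r + s → ∀ z → Free z (hintikka t s σ) → z < s
  hintikka-free = hintikka-induction (λ _ s → FreeBelow s)
    (λ {s} σ 0<s → All⇒diagram (FreeBelow s) (λ a b z → [ a z , b z ]) σ 0<s λ {α} b →
      literal-elim (FreeBelow s) σ α (atom-below α b) (atom-below α b))
    (λ {_} {s} φ∈ below →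
      All⇒⋀ (FreeBelow s) (λ a b z → [ a z , b z ]) (∈-map⁺ _ φ∈) (All.map⁺ (All.map (λ {φ} → bind ∃q φ) below)))
    (λ {_} {s} {Φs = Φs} φ∈ below →
      bind ∀q (⋁ Φs) (All⇒⋁ (FreeBelow (suc s)) (λ a b z → [ a z , b z ]) φ∈ below))
    (λ a b z → [ a z , b z ])
    where
    FreeBelow : ℕ → Formula → Set
    FreeBelow n A = ∀ z → Free z A → z < n
    atom-below : ∀ {s} α → Below s α → FreeBelow s (atom α)
    atom-below α b z = Below⇒Occurs< b ∘ Free⇒Occurs (atom α)
    bind : ∀ {s} q A → FreeBelow (suc s) A → FreeBelow s (Q q s A)
    bind q A fa z (z≢s , f) = ≤∧≢⇒< (s≤s⁻¹ (fa z f)) z≢s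

  hintikka-occurs : ∀ {r} (t : Trie r) s σ → 0 < r + s → OccursBelow (s + r) (hintikka t s σ)
  hintikka-occurs = hintikka-induction (λ {r} _ s → OccursBelow (s + r))
    (λ {s} σ 0<s → All⇒diagram (OccursBelow (s + 0)) (λ a b z → [ a z , b z ]) σ 0<s λ {α} b →
      literal-elim (OccursBelow (s + 0)) σ α (atom-below b) (atom-below b))
    (λ {r} {s} φ∈ below → All⇒⋀ (OccursBelow (s + suc r)) (λ a b z → [ a z , b z ]) (∈-map⁺ _ φ∈)
      (All.map⁺ (All.map (λ {φ} → bind ∃q φ) below)))
    (λ {r} {s} {Φs = Φs} φ∈ below →
      bind ∀q (⋁ Φs) (All⇒⋁ (OccursBelow (suc s + r)) (λ a b z → [ a z , b z ]) φ∈ below))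
    (λ a b z → [ a z , b z ])
    where
    atom-below : ∀ {s α} → Below s α → OccursBelow (s + 0) (atom α)
    atom-below {s} b z o = <-≤-trans (Below⇒Occurs< b o) (m≤m+n s 0)
    bind : ∀ {r s} q A → OccursBelow (suc s + r) A → OccursBelow (s + suc r) (Q q s A)
    bind {r} {s} q A _  z (inj₁ refl) = m<m+n s (s≤s z≤n)
    bind {r} {s} q A oa z (inj₂ o)    = subst (z <_) (sym (+-suc s r)) (oa z o)

  hintikka-paths : ∀ {r} (t : Trie r) s σ → 0 < r + s → PathsIn t s (hintikka t s σ)
  hintikka-paths = hintikka-induction PathsIn
    (λ {s} σ 0<s → All⇒diagram (PathsIn leaf s) (PathsIn-∧ {t = leaf} {s}) σ 0<s λ {α} _ →
      literal-elim (PathsIn leaf s) σ α (PathsIn-atom {s} α) (λ π → λ { (p¬ p) → PathsIn-atom {s} α π p }))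
    (λ φ∈ paths → All⇒⋀ (PathsIn _ _) PathsIn-∧ (∈-map⁺ _ φ∈) (All.map⁺ (All.map PathsIn-∃ paths)))
    (λ φ∈ paths → PathsIn-∀ (All⇒⋁ (PathsIn _ _) PathsIn-∨ φ∈ paths))
    λ {_} {_} {e} {a} pe pa π → λ
      { (p∧ˡ p) → Data.Product.map₂ (∈-∪⁺ˡ (∃ᵗ e) (∀ᵗ a) (map proj₁ π)) (pe π p)
      ; (p∧ʳ p) → Data.Product.map₂ (∈-∪⁺ʳ (∃ᵗ e) (∀ᵗ a) (map proj₁ π)) (pa π p) }

  atom-transfer : ∀ {r} (t : Trie r) s σ α → PathsIn t s (atom α) → OccursBelow (s + r) (atom α) →
                  ∀ {G′} {σ′ : Assignment G′} → Sat G′ σ′ (hintikka t s σ) →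
                  Sat G σ (atom α) ⇔ Sat G′ σ′ (atom α)
  atom-transfer {zero}  leaf s σ α _     occ h =
    diagram-transfer σ α h (λ z o → subst (z <_) (+-identityʳ s) (occ z o))
  atom-transfer {suc r} t    s σ α paths _   _ = ⊥-elim (PathsIn-atom⁻ α paths)

  hintikka-entails : ∀ {r} (t : Trie r) s σ {C} → NNF C → PathsIn t s C → OccursBelow (s + r) C →
                     Sat G σ C → ∀ {G′} {σ′ : Assignment G′} → Sat G′ σ′ (hintikka t s σ) → Sat G′ σ′ C
  ∃-transfer : ∀ {r} (e : Trie r) s σ {A} → NNF A → PathsIn e (suc s) A → OccursBelow (suc s + r) A →
               Sat G σ (Q ∃q s A) → ∀ {G′} {σ′ : Assignment G′} →
               Sat G′ σ′ (⋀∃ s (successors e s σ)) → Sat G′ σ′ (Q ∃q s A)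
  ∀-transfer : ∀ {r} (a : Trie r) s σ {A} → NNF A → PathsIn a (suc s) A → OccursBelow (suc s + r) A →
               Sat G σ (Q ∀q s A) → ∀ {G′} {σ′ : Assignment G′} →
               Sat G′ σ′ (∀⋁ s (successors a s σ)) → Sat G′ σ′ (Q ∀q s A)

  hintikka-entails t s σ (atom≐ x y) paths occ sat h =
    Equivalence.to (atom-transfer t s σ (x ≐ₐ y) paths occ h) sat
  hintikka-entails t s σ (atom⟼ x y) paths occ sat h =
    Equivalence.to (atom-transfer t s σ (x ⟼ₐ y) paths occ h) sat
  hintikka-entails t s σ (neg≐ x y) paths occ sat h =
    sat ∘ Equivalence.from (atom-transfer t s σ (x ≐ₐ y) (λ π → paths π ∘ p¬) occ h)
  hintikka-entails t s σ (neg⟼ x y) paths occ sat h =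
    sat ∘ Equivalence.from (atom-transfer t s σ (x ⟼ₐ y) (λ π → paths π ∘ p¬) occ h)
  hintikka-entails t s σ (and nA nB) paths occ (a , b) h =
    hintikka-entails t s σ nA (λ π → paths π ∘ p∧ˡ) (λ z → occ z ∘ inj₁) a h ,
    hintikka-entails t s σ nB (λ π → paths π ∘ p∧ʳ) (λ z → occ z ∘ inj₂) b h
  hintikka-entails t s σ (or nA nB) paths occ (inj₁ a) h =
    inj₁ (hintikka-entails t s σ nA (λ π → paths π ∘ p∨ˡ) (λ z → occ z ∘ inj₁) a h)
  hintikka-entails t s σ (or nA nB) paths occ (inj₂ b) h =
    inj₂ (hintikka-entails t s σ nB (λ π → paths π ∘ p∨ʳ) (λ z → occ z ∘ inj₂) b h)
  hintikka-entails leaf s σ (quant {q} {x} {A} _) paths = ⊥-elim (PathsIn-leaf-Q {s} {q} {x} {A} paths)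
  hintikka-entails (∃ᵗ e) s σ (quant {∀q} _) paths = ⊥-elim (proj₂ (proj₂ (PathsIn-Q {t = ∃ᵗ e} paths)))
  hintikka-entails (∀ᵗ a) s σ (quant {∃q} _) paths = ⊥-elim (proj₂ (proj₂ (PathsIn-Q {t = ∀ᵗ a} paths)))
  hintikka-entails (∃ᵗ e) s σ (quant {∃q} {A = A} nA) paths occ sat h
    with refl ← proj₁ (PathsIn-Q {t = ∃ᵗ e} paths) =
    ∃-transfer e s σ nA (PathsIn-Q⁻ (λ p → p) paths) (OccursBelow-Q ∃q A occ) sat h
  hintikka-entails (∀ᵗ a) s σ (quant {∀q} {A = A} nA) paths occ sat h
    with refl ← proj₁ (PathsIn-Q {t = ∀ᵗ a} paths) =
    ∀-transfer a s σ nA (PathsIn-Q⁻ (λ p → p) paths) (OccursBelow-Q ∀q A occ) sat h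
  hintikka-entails (∃∀ᵗ e a) s σ (quant {∃q} {A = A} nA) paths occ sat h
    with refl ← proj₁ (PathsIn-Q {t = ∃∀ᵗ e a} paths) =
    ∃-transfer e s σ nA (PathsIn-Q⁻ (λ p → p) paths) (OccursBelow-Q ∃q A occ) sat (proj₁ h)
  hintikka-entails (∃∀ᵗ e a) s σ (quant {∀q} {A = A} nA) paths occ sat h
    with refl ← proj₁ (PathsIn-Q {t = ∃∀ᵗ e a} paths) =
    ∀-transfer a s σ nA (PathsIn-Q⁻ (λ p → p) paths) (OccursBelow-Q ∀q A occ) sat (proj₂ h)

  ∃-transfer e s σ nA paths occ (v , sat) h =
    let w , h′ = ⋀∃⁻ h (successor∈ e s σ v) in
    w , hintikka-entails e (suc s) (update G σ s v) nA paths occ sat h′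

  ∀-transfer a s σ nA paths occ sat h w =
    let φ , φ∈ , h′ = ∀⋁⁻ (successor∈ a s σ Fin.zero) h w
        v , eq = ∈-successors⁻ a s σ φ∈
    in hintikka-entails a (suc s) (update G σ s v) nA paths occ (sat v) (subst (Sat _ _) (sym eq) h′)


  literal-length : ∀ σ α → L (literal σ α) ≤ 4
  literal-length σ α = literal-elim (λ φ → L φ ≤ 4) σ α (≤-trans (≤-reflexive (L-atom α)) (n≤1+n 3))
                                                       (s≤s (≤-reflexive (L-atom α)))
    where
    L-atom : ∀ α → L (atom α) ≡ 3
    L-atom (x ≐ₐ y) = refl
    L-atom (x ⟼ₐ y) = refl

  L-hintikka : ∀ {r} (t : Trie r) s σ {n} → r + s ≡ n →
                    L (hintikka t s σ) ≤ lengthBound (length (atoms n)) r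
  successors-length : ∀ {r} (t : Trie r) s σ {n} → suc r + s ≡ n →
                      All (λ φ → L φ ≤ lengthBound (length (atoms n)) r) (successors t s σ)

  successors-length {r} t s σ {n} eq = All.tabulate λ φ∈ →
    let _ , hφ = ∈-successors⁻ t s σ φ∈ in
    subst (λ φ → L φ ≤ lengthBound (length (atoms n)) r) hφ (L-hintikka t (suc s) _ (trans (+-suc r s) eq))

  module _ {r} (t : Trie r) (s : ℕ) (σ : Assignment G) {n : ℕ} (eq : suc r + s ≡ n) where
    private
      N ℓ : ℕ
      N = 2 ^ countExp (length (atoms n)) r
      ℓ = lengthBound (length (atoms n)) r

    length-successors : length (successors t s σ) ≤ N
    length-successors = ≤-trans (length-filter (successor? t s σ) (candidates t (suc s)))
                                (length-candidates t (suc s) (trans (+-suc r s) eq))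

    L-∃-successors : L (⋀∃ s (successors t s σ)) ≤ 3 + N * (ℓ + 5)
    L-∃-successors = ≤-trans (L-⋀∃ s (successors t s σ) (successors-length t s σ eq))
                       (+-monoʳ-≤ 3 (*-monoˡ-≤ (ℓ + 5) length-successors))

    L-∀-successors : L (∀⋁ s (successors t s σ)) ≤ 5 + N * (ℓ + 5)
    L-∀-successors = ≤-trans (L-∀⋁ s (successors t s σ) (successors-length t s σ eq))
                       (+-monoʳ-≤ 5 (*-mono-≤ length-successors (+-monoʳ-≤ ℓ (m≤m+n 3 2))))

  L-hintikka leaf s σ refl = begin
    L (⋀ (map (literal σ) (atoms s)))                 ≤⟨ L-⋀ (λ _ _ → refl) (map (literal σ) (atoms s))
                                                           (All.map⁺ (All.tabulate λ {α} _ → literal-length σ α)) ⟩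
    3 + length (map (literal σ) (atoms s)) * (4 + 3)  ≡⟨ cong (λ k → 3 + k * 7) (length-map (literal σ) (atoms s)) ⟩
    3 + length (atoms s) * 7                          ∎
    where open ≤-Reasoning
  L-hintikka (∃ᵗ e) s σ eq = ≤-trans (L-∃-successors e s σ eq) (+-mono-≤ (m≤m+n 3 8) (m≤m+n _ _))
  L-hintikka (∀ᵗ a) s σ eq = ≤-trans (L-∀-successors a s σ eq) (+-mono-≤ (m≤m+n 5 6) (m≤m+n _ _))
  L-hintikka (∃∀ᵗ {r} e a) s σ {n} eq = begin
    3 + L (⋀∃ s (successors e s σ)) + L (∀⋁ s (successors a s σ))
      ≤⟨ +-mono-≤ (+-monoʳ-≤ 3 (L-∃-successors e s σ eq)) (L-∀-successors a s σ eq) ⟩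
    3 + (3 + X) + (5 + X)
      ≡⟨ regroup X ⟩
    11 + 2 * X ∎
    where
    open ≤-Reasoning
    X : ℕ
    X = 2 ^ countExp (length (atoms n)) r * (lengthBound (length (atoms n)) r + 5)
    regroup : ∀ X → 3 + (3 + X) + (5 + X) ≡ 11 + 2 * X
    regroup = solve-∀

n<2^n : ∀ n → n < 2 ^ n
n<2^n zero    = s≤s z≤n
n<2^n (suc n) = begin-strict
  suc n           ≤⟨ n<2^n n ⟩
  2 ^ n           <⟨ m<m+n (2 ^ n) (m^n>0 2 n) ⟩
  2 ^ n + 2 ^ n   ≡⟨ 2^-double n ⟩
  2 ^ suc n       ∎
  where open ≤-Reasoning

2*n≤2^n : ∀ n → 2 * n ≤ 2 ^ n
2*n≤2^n zero    = z≤n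
2*n≤2^n (suc n) = *-monoʳ-≤ 2 (n<2^n n)

lengthBound-step : ∀ M r → lengthBound M r + 5 ≤ 2 ^ (countExp M r + 3) →
                   lengthBound M (suc r) + 5 ≤ 2 ^ (2 * countExp M r + 5)
lengthBound-step M r ℓ+5≤ = begin
  11 + 2 * (2 ^ c * (ℓ + 5)) + 5     ≡⟨ regroup (2 ^ c * (ℓ + 5)) ⟩
  16 + 2 * (2 ^ c * (ℓ + 5))         ≤⟨ +-monoʳ-≤ 16 (*-monoʳ-≤ 2 (*-monoʳ-≤ (2 ^ c) ℓ+5≤)) ⟩
  16 + 2 * (2 ^ c * 2 ^ (c + 3))     ≡⟨ cong (λ k → 16 + 2 * k) (^-distribˡ-+-* 2 c (c + 3)) ⟨
  16 + 2 ^ suc (c + (c + 3))         ≡⟨ cong (λ k → 16 + 2 ^ k) (exponent c) ⟩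
  16 + 2 ^ (2 * c + 4)               ≤⟨ +-monoˡ-≤ (2 ^ (2 * c + 4)) (^-monoʳ-≤ 2 (m≤n+m 4 (2 * c))) ⟩
  2 ^ (2 * c + 4) + 2 ^ (2 * c + 4)  ≡⟨ 2^-double (2 * c + 4) ⟩
  2 ^ suc (2 * c + 4)                ≡⟨ cong (2 ^_) (+-suc (2 * c) 4) ⟨
  2 ^ (2 * c + 5)                    ∎
  where
  open ≤-Reasoning
  c ℓ : ℕ
  c = countExp M r
  ℓ = lengthBound M r
  regroup : ∀ X → 11 + 2 * X + 5 ≡ 16 + 2 * X
  regroup = solve-∀
  exponent : ∀ c → suc (c + (c + 3)) ≡ 2 * c + 4
  exponent = solve-∀

lengthBound-exp : ∀ M r → lengthBound M r + 5 ≤ 2 ^ (countExp M r + 3)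
lengthBound-exp M zero = begin
  3 + M * 7 + 5   ≤⟨ m≤m+n (3 + M * 7 + 5) M ⟩
  3 + M * 7 + 5 + M ≡⟨ regroup M ⟩
  suc M * 8       ≤⟨ *-monoˡ-≤ 8 (n<2^n M) ⟩
  2 ^ M * 2 ^ 3   ≡⟨ ^-distribˡ-+-* 2 M 3 ⟨
  2 ^ (M + 3)     ∎
  where
  open ≤-Reasoning
  regroup : ∀ M → 3 + M * 7 + 5 + M ≡ suc M * 8
  regroup = solve-∀
lengthBound-exp M (suc r) = begin
  lengthBound M (suc r) + 5   ≤⟨ lengthBound-step M r (lengthBound-exp M r) ⟩
  2 ^ (2 * c + 5)             ≡⟨ cong (2 ^_) (regroup c) ⟩
  2 ^ (2 * suc c + 3)         ≤⟨ ^-monoʳ-≤ 2 (+-monoˡ-≤ 3 (2*n≤2^n (suc c))) ⟩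
  2 ^ (2 ^ suc c + 3)         ∎
  where
  open ≤-Reasoning
  c : ℕ
  c = countExp M r
  regroup : ∀ c → 2 * c + 5 ≡ 2 * suc c + 3
  regroup = solve-∀

countExp-Tower : ∀ M k r → 2 * M + 5 ≤ Tower k → 2 * countExp M r + 5 ≤ Tower (r + k)
countExp-Tower M k zero    base = base
countExp-Tower M k (suc r) base = begin
  2 ^ (2 + c) + 5              ≤⟨ +-mono-≤ (^-monoʳ-≤ 2 (n≤1+n (2 + c)))
                                           (≤-trans (m≤m+n 5 3) (^-monoʳ-≤ 2 (m≤m+n 3 c))) ⟩
  2 ^ (3 + c) + 2 ^ (3 + c)    ≡⟨ 2^-double (3 + c) ⟩
  2 ^ (4 + c)                  ≤⟨ ^-monoʳ-≤ 2 (≤-trans (m≤m+n (4 + c) (suc c)) (≤-reflexive (regroup c))) ⟩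
  2 ^ (2 * c + 5)              ≤⟨ ^-monoʳ-≤ 2 (countExp-Tower M k r base) ⟩
  2 ^ Tower (r + k)            ∎
  where
  open ≤-Reasoning
  c : ℕ
  c = countExp M r
  regroup : ∀ c → 4 + c + suc c ≡ 2 * c + 5
  regroup = solve-∀

lengthBound-Tower : ∀ M k r → 2 * M + 5 ≤ Tower k → lengthBound M (suc r) < Tower (suc r + k)
lengthBound-Tower M k r base = begin-strict
  lengthBound M (suc r)       <⟨ m<m+n (lengthBound M (suc r)) (s≤s z≤n) ⟩
  lengthBound M (suc r) + 5   ≤⟨ lengthBound-step M r (lengthBound-exp M r) ⟩
  2 ^ (2 * countExp M r + 5)  ≤⟨ ^-monoʳ-≤ 2 (countExp-Tower M k r base) ⟩
  2 ^ Tower (r + k)           ∎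
  where open ≤-Reasoning

atoms-bound : ∀ d → 2 * length (atoms (2 + d)) + 5 ≤ 2 ^ (2 * (2 + d))
atoms-bound zero    = m≤m+n 15 1
atoms-bound (suc d) = begin
  2 * length (atoms (suc k)) + 5               ≡⟨ cong (λ k → 2 * k + 5) (length-atoms k) ⟩
  2 * (suc (k + (k + k)) + Lₐ) + 5             ≤⟨ m≤m+n _ 1 ⟩
  2 * (suc (k + (k + k)) + Lₐ) + 5 + 1         ≡⟨ regroup k Lₐ ⟩
  (2 * Lₐ + 5) + 3 * suc (2 * k)               ≤⟨ +-mono-≤ (atoms-bound d) (*-monoʳ-≤ 3 (n<2^n (2 * k))) ⟩
  2 ^ (2 * k) + 3 * 2 ^ (2 * k)                ≡⟨ quadruple (2 ^ (2 * k)) ⟩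
  2 ^ suc (suc (2 * k))                        ≡⟨ cong (2 ^_) (double-suc k) ⟨
  2 ^ (2 * suc k)                              ∎
  where
  open ≤-Reasoning
  k Lₐ : ℕ
  k  = 2 + d
  Lₐ = length (atoms k)
  regroup : ∀ D L → 2 * (suc (D + (D + D)) + L) + 5 + 1 ≡ (2 * L + 5) + 3 * suc (2 * D)
  regroup = solve-∀
  quadruple : ∀ X → X + 3 * X ≡ 2 * (2 * X)
  quadruple = solve-∀
  double-suc : ∀ D → 2 * suc D ≡ suc (suc (2 * D))
  double-suc = solve-∀

n≤2^⌈log₂n⌉ : ∀ n → n ≤ 2 ^ ⌈log₂ n ⌉
n≤2^⌈log₂n⌉ n = go n (<-wellFounded n)
  where
  go : ∀ n (acc : Acc _<_ n) → n ≤ 2 ^ ⌈log2⌉ n acc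
  go zero          _        = z≤n
  go (suc zero)    _        = ≤-refl
  go (suc (suc n)) (acc rs) = begin
    suc (suc n)                  ≤⟨ s≤s (s≤s n≤2⌈n/2⌉) ⟩
    suc (suc (⌈ n /2⌉ + ⌈ n /2⌉)) ≡⟨ cong suc (+-suc ⌈ n /2⌉ ⌈ n /2⌉) ⟨
    suc ⌈ n /2⌉ + suc ⌈ n /2⌉      ≤⟨ +-mono-≤ ih ih ⟩
    2 ^ k + 2 ^ k                ≡⟨ 2^-double k ⟩
    2 ^ suc k                    ∎
    where
    open ≤-Reasoning
    k : ℕ
    k = ⌈log2⌉ (suc ⌈ n /2⌉) (rs (⌈n/2⌉<n n))
    ih : suc ⌈ n /2⌉ ≤ 2 ^ k
    ih = go (suc ⌈ n /2⌉) (rs (⌈n/2⌉<n n))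
    n≤2⌈n/2⌉ : n ≤ ⌈ n /2⌉ + ⌈ n /2⌉
    n≤2⌈n/2⌉ = subst (_≤ ⌈ n /2⌉ + ⌈ n /2⌉) (⌊n/2⌋+⌈n/2⌉≡n n) (+-monoˡ-≤ ⌈ n /2⌉ (⌊n/2⌋≤⌈n/2⌉ n))

⌈log₂n⌉<n : ∀ n → 2 ≤ n → ⌈log₂ n ⌉ < n
⌈log₂n⌉<n (suc zero)    (s≤s ())
⌈log₂n⌉<n (suc (suc m)) _ = s≤s (begin
  ⌈log₂ suc (suc m) ⌉    ≤⟨ ⌈log₂⌉-mono-≤ (n<2^n (suc m)) ⟩
  ⌈log₂ 2 ^ suc m ⌉      ≡⟨ ⌈log₂2^n⌉≡n (suc m) ⟩
  suc m                  ∎)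
  where open ≤-Reasoning

log*-fuel-bound : ∀ f n → n ≤ f → n ≤ Tower (log*-fuel f n)
log*-fuel-bound zero    zero          _   = z≤n
log*-fuel-bound (suc f) zero          _   = z≤n
log*-fuel-bound (suc f) (suc zero)    _   = ≤-refl
log*-fuel-bound (suc f) n@(suc (suc m)) n≤1+f = ≤-trans (n≤2^⌈log₂n⌉ n)
  (^-monoʳ-≤ 2 (log*-fuel-bound f ⌈log₂ n ⌉ (s≤s⁻¹ (<-≤-trans (⌈log₂n⌉<n n (s≤s (s≤s z≤n))) n≤1+f))))

log*-bound : ∀ n → n ≤ Tower (log* n)
log*-bound n = log*-fuel-bound n n ≤-refl

atoms-bound-Tower : ∀ d → 2 * length (atoms (2 + d)) + 5 ≤ Tower (log* (2 + d) + 2)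
atoms-bound-Tower d = begin
  2 * length (atoms (2 + d)) + 5  ≤⟨ atoms-bound d ⟩
  2 ^ (2 * (2 + d))                ≤⟨ ^-monoʳ-≤ 2 (*-monoʳ-≤ 2 (log*-bound (2 + d))) ⟩
  2 ^ (2 * t)                      ≤⟨ ^-monoʳ-≤ 2 (2*n≤2^n t) ⟩
  Tower (2 + log* (2 + d))         ≡⟨ cong Tower (+-comm 2 (log* (2 + d))) ⟩
  Tower (log* (2 + d) + 2)         ∎
  where
  open ≤-Reasoning
  t : ℕ
  t = Tower (log* (2 + d))

lengthBound<Tower : ∀ d → lengthBound (length (atoms (2 + d))) (2 + d) < Tower (2 + d + log* (2 + d) + 2)
lengthBound<Tower d = subst (λ k → lengthBound (length (atoms (2 + d))) (2 + d) < Tower k)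
  (sym (+-assoc (2 + d) (log* (2 + d)) 2))
  (lengthBound-Tower (length (atoms (2 + d))) (log* (2 + d) + 2) (suc d) (atoms-bound-Tower d))

module _ {G H : Digraph} (π : Vertex H → Vertex G) (ι : Vertex G → Vertex H)
         (π∘ι : ∀ v → π (ι v) ≡ v) (strong : ∀ u v → arc H u v ≡ arc G (π u) (π v)) where

  private
    π-update : ∀ (ρ : Assignment H) x u A →
               Sat G (π ∘ update H ρ x u) A ⇔ Sat G (update G (π ∘ ρ) x (π u)) A
    π-update ρ x u A = mk⇔ (coincidence G A (λ z _ → commute z)) (coincidence G A (λ z _ → sym (commute z)))
      where
      commute : ∀ z → π (update H ρ x u z) ≡ update G (π ∘ ρ) x (π u) z
      commute z with z ≡ᵇ x
      ... | true  = refl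
      ... | false = refl

    π-section : ∀ (ρ : Assignment G) x w A → Sat G (update G ρ x (π (ι w))) A → Sat G (update G ρ x w) A
    π-section ρ x w A = subst (λ v → Sat G (update G ρ x v) A) (π∘ι w)

  -- Equality atoms are the only obstruction, and in one variable they are trivial.
  one-variable-invariant : ∀ A → OccursBelow 1 A → ∀ ρ → Sat H ρ A ⇔ Sat G (π ∘ ρ) A
  one-variable-invariant (x ≐ y) occ ρ
    with refl ← n<1⇒n≡0 (occ x (inj₁ refl)) | refl ← n<1⇒n≡0 (occ y (inj₂ refl)) =
    mk⇔ (λ _ → refl) (λ _ → refl)
  one-variable-invariant (x ⟼ y) occ ρ = mk⇔ (trans (sym (strong _ _))) (trans (strong _ _))
  one-variable-invariant (¬' A) occ ρ =
    let A⇔ = one-variable-invariant A occ ρ in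
    mk⇔ (λ ¬a → ¬a ∘ Equivalence.from A⇔) (λ ¬a → ¬a ∘ Equivalence.to A⇔)
  one-variable-invariant (A ∧' B) occ ρ =
    one-variable-invariant A (λ z → occ z ∘ inj₁) ρ ×-⇔ one-variable-invariant B (λ z → occ z ∘ inj₂) ρ
  one-variable-invariant (A ∨' B) occ ρ =
    one-variable-invariant A (λ z → occ z ∘ inj₁) ρ ⊎-⇔ one-variable-invariant B (λ z → occ z ∘ inj₂) ρ
  one-variable-invariant (Q ∀q x A) occ ρ = mk⇔
    (λ h w → π-section (π ∘ ρ) x w A (Equivalence.to (π-update ρ x (ι w) A) (Equivalence.to (IH _) (h (ι w)))))
    (λ h v → Equivalence.from (IH _) (Equivalence.from (π-update ρ x v A) (h (π v))))
    where
    IH : ∀ ρ → Sat H ρ A ⇔ Sat G (π ∘ ρ) A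
    IH = one-variable-invariant A (λ z → occ z ∘ inj₂)
  one-variable-invariant (Q ∃q x A) occ ρ = mk⇔
    (λ (v , a) → π v , Equivalence.to (π-update ρ x v A) (Equivalence.to (IH _) a))
    (λ (w , a) → ι w , Equivalence.from (IH _) (Equivalence.from (π-update ρ x (ι w) A)
                                                  (subst (λ v → Sat G (update G (π ∘ ρ) x v) A) (sym (π∘ι w)) a)))
    where
    IH : ∀ ρ → Sat H ρ A ⇔ Sat G (π ∘ ρ) A
    IH = one-variable-invariant A (λ z → occ z ∘ inj₂)

collapse : ∀ {n} → Fin (suc (suc n)) → Fin (suc n)
collapse Fin.zero    = Fin.zero
collapse (Fin.suc i) = i

blowUp : Digraph → Digraph
blowUp G = record { size = suc (size G) ; arc = λ u v → arc G (collapse u) (collapse v) }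

blowUp≇ : ∀ G → ¬ (blowUp G ≅ G)
blowUp≇ G iso = 1+n≰n (injective⇒≤ (Injection.injective (↔⇒↣ (_≅_.bij iso))))

one-variable-undefinable : ∀ {Φ G} → OccursBelow 1 Φ → ¬ Defines Φ G
one-variable-undefinable {Φ} {G} occ (_ , holds , unique) = unique (blowUp G) (blowUp≇ G) λ ρ →
  Equivalence.from (one-variable-invariant collapse Fin.suc (λ _ → refl) (λ _ _ → refl) Φ occ ρ) (holds _)

length-range : ∀ s r → length (range s r) ≡ r
length-range s zero    = refl
length-range s (suc r) = cong suc (length-range (suc s) r)

Normal⇒∈prefixTrie : ∀ {s r A} → Normal s r A → ∀ {π} → Path A π → map proj₁ π ∈ᵐ prefixTrie r A
Normal⇒∈prefixTrie {s} {r} {A} (_ , _ , _ , _ , vars) {π} p = subst (λ k → map proj₁ π ∈ᵐ prefixTrie k A)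
  (trans (sym (length-map proj₂ π)) (trans (cong length (vars π p)) (length-range s r))) (prefixTrie-complete p)

normal-trie : ∀ {s r A} → Normal s r A →
              ∃[ t ] PathsIn t s A × (∀ qs → qs ∈ᵗ t → ∃[ π ] Path A π × map proj₁ π ≡ qs)
normal-trie {s} {r} {A} normA@(_ , _ , _ , _ , vars) with prefixTrie r A in eq
... | just t  = t , (λ π p → vars π p , subst (map proj₁ π ∈ᵐ_) eq (Normal⇒∈prefixTrie normA p)) ,
                λ qs q∈ → prefixTrie-sound r A qs (subst (qs ∈ᵐ_) (sym eq) q∈)
... | nothing with π , p ← somePath A = ⊥-elim (subst (map proj₁ π ∈ᵐ_) eq (Normal⇒∈prefixTrie normA p))

Sentence⇒FreeExactly0 : ∀ {A} → Sentence A → FreeExactly 0 A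
Sentence⇒FreeExactly0 closed z = (λ f → ⊥-elim (closed z f)) , λ ()

FreeExactly0⇒Sentence : ∀ {A} → FreeExactly 0 A → Sentence A
FreeExactly0⇒Sentence free z f with () ← proj₁ (free z) f

Defines-equivalent : ∀ {Φ Ψ G} → Equivalent Φ Ψ → Sentence Ψ → Defines Φ G → Defines Ψ G
Defines-equivalent Φ⇔Ψ closed (_ , holds , unique) =
  closed , (λ ρ → proj₁ (Φ⇔Ψ _ ρ) (holds ρ)) , λ H H≇G holdsΨ → unique H H≇G λ ρ → proj₂ (Φ⇔Ψ H ρ) (holdsΨ ρ)

module _ (F : Formula → Set) (regular : Regular F) where
  open Regular regular

  hintikka-definition : ∀ {B G k} → F B → Normal 0 (suc k) B → Defines B G →
                        ∃[ H ] F H × Defines H G × L H ≤ lengthBound (length (atoms (suc k))) (suc k)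
  hintikka-definition {B} {G} {k} FB normB@(_ , _ , nnfB , occB , _) (_ , holdsB , uniqueB) =
    H , FH , (closedH , holdsH , uniqueH) , L-hintikka t 0 σ₀ (+-identityʳ (suc k))
    where
    open Hintikka G
    t : Trie (suc k)
    t = proj₁ (normal-trie normB)
    pathsB : PathsIn t 0 B
    pathsB = proj₁ (proj₂ (normal-trie normB))
    soundB : ∀ qs → qs ∈ᵗ t → ∃[ π ] Path B π × map proj₁ π ≡ qs
    soundB = proj₂ (proj₂ (normal-trie normB))
    σ₀ : Assignment G
    σ₀ _ = Fin.zero
    H : Formula
    H = hintikka t 0 σ₀
    0<k : 0 < suc k + 0
    0<k = s≤s z≤n
    closedH : Sentence H
    closedH z f with () ← hintikka-free t 0 σ₀ 0<k z f
    normH : Normal 0 (suc k) H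
    normH = Sentence⇒FreeExactly0 {H} closedH , hintikka-rank t 0 σ₀ 0<k , hintikka-nnf t 0 σ₀ 0<k ,
            hintikka-occurs t 0 σ₀ 0<k , λ π p → proj₁ (hintikka-paths t 0 σ₀ 0<k π p)
    FH : F H
    FH = let P , P⇔ = prefixes (suc k) (s≤s z≤n) in
      proj₂ (P⇔ H normH) λ π p →
        let π′ , p′ , same = soundB _ (proj₂ (hintikka-paths t 0 σ₀ 0<k π p)) in
        subst P same (proj₁ (P⇔ B normB) FB π′ p′)
    holdsH : Holds G H
    holdsH ρ = sentence-closed G H closedH (hintikka-holds t 0 σ₀ 0<k)
    uniqueH : ∀ G′ → ¬ (G′ ≅ G) → ¬ Holds G′ H
    uniqueH G′ G′≇G holds′ = uniqueB G′ G′≇G λ ρ →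
      hintikka-entails t 0 σ₀ nnfB pathsB occB (holdsB σ₀) (holds′ ρ)

  short-definition : ∀ {B G} d → F B → Normal 0 d B → Defines B G →
                     ∃[ H ] F H × Defines H G × L H < Tower (d + log* d + 2)
  short-definition {B} zero FB (_ , _ , _ , occB , _) _ with z , o ← someOccurrence B with () ← occB z o
  short-definition (suc zero) FB (_ , _ , _ , occB , _) defB = ⊥-elim (one-variable-undefinable occB defB)
  short-definition (suc (suc r)) FB normB defB =
    let H , FH , defH , L≤ = hintikka-definition FB normB defB in
    H , FH , defH , ≤-<-trans L≤ (lengthBound<Tower r)

theorem8 : (F : Formula → Set) → Regular F → (G : Digraph) → Definable F G →
           ∀ l d → IsLF F G l → IsDF F G d →
           l < Tower (d + log* d + 2)
theorem8 F regular G _ l d (_ , minimal) ((Φ , FΦ , defΦ , DΦ≡d) , _) =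
  let B , FB , normB , Φ⇔B = Regular.normal regular 0 Φ FΦ (Sentence⇒FreeExactly0 {Φ} (proj₁ defΦ))
      defB = Defines-equivalent Φ⇔B (FreeExactly0⇒Sentence {B} (proj₁ normB)) defΦ
      H , FH , defH , L<Tower = short-definition F regular d FB (subst (λ k → Normal 0 k B) DΦ≡d normB) defB
  in ≤-<-trans (minimal H FH defH) L<Tower
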